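{- Let $q=ef+1$ be a prime power with $q\equiv1\pmod4$, $e$ even and $f=2$, and let ${C_0^2}'=\{C_0^e,C_2^e,\ldots,C_{e-2}^e\}$ (a family of $\frac{q-1}{4}$ sets of size $2$). Then (i) when $q\equiv1\pmod8$, ${C_0^2}'$ is a $(q,\frac{q-1}{4},2,1,0)$-disjoint partial difference family and a $(q,\frac{q-1}{4},2,\frac{q-9}{4},\frac{q-1}{4})$-external partial difference family; (ii) when $q\equiv5\pmod8$, ${C_0^2}'$ is a $(q,\frac{q-1}{4},2,0,1)$-disjoint partial difference family and a $(q,\frac{q-1}{4},2,\frac{q-5}{4})$-external difference family.
   Context: $G=(GF(q),+)$, $G^*=G\setminus\{0\}$; $\alpha$ a primitive element; $C_i^d=\alpha^i\langle\alpha^d\rangle$ for $d\mid q-1$. $\Delta(D)$ is the multiset $\{x-y:x,y\in D,x\neq y\}$, $\Delta(D_1,D_2)$ the multiset $\{x-y:x\in D_1,y\in D_2\}$, $\lambda A$ is $\lambda$ copies of each element of $A$. For a family of $m$ disjoint $k$-subsets $D_i$ of $G^*$ with union $S$: $(q,m,k,\lambda,\mu)$-disjoint (resp. external) partial difference family means $\bigcup_i\Delta(D_i)$ (resp. $\bigcup_{i\neq j}\Delta(D_i,D_j)$) equals $\lambda S+\mu(G^*\setminus S)$; $(q,m,k,\lambda)$-external difference family means $\bigcup_{i\neq j}\Delta(D_i,D_j)=\lambda G^*$. -}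

module Defs where

open import Level using (0ℓ)
open import Algebra.Bundles using (CommutativeRing)
open import Data.Nat as ℕ using (ℕ; zero; suc; _<_; _∸_)
open import Data.List using (List; []; _∷_; length; filter; map; concatMap; concat; upTo; allFin; lookup)
open import Data.List.Relation.Unary.Any using (Any)
open import Data.List.Relation.Unary.All using (All)
open import Data.Fin using (Fin)
open import Data.Product using (Σ; _×_; _,_; ∃)
open import Relation.Nullary using (¬_; Dec; yes; no)
open import Relation.Binary using (Decidable)
open import Relation.Binary.PropositionalEquality using (_≡_)

record FiniteField : Set₁ where
  field
    cring     : CommutativeRing 0ℓ 0ℓ
  open CommutativeRing cring public
  field
    _≟_       : Decidable _≈_
    0≉1       : ¬ (0# ≈ 1#)
    inverse   : ∀ x → ¬ (x ≈ 0#) → Σ Carrier λ y → (x * y) ≈ 1#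
    elements  : List Carrier
    enumerate : ∀ x → length (filter (λ y → y ≟ x) elements) ≡ 1

  order : ℕ
  order = length elements

  pow : Carrier → ℕ → Carrier
  pow x zero    = 1#
  pow x (suc n) = x * pow x n

  IsPrimitive : Carrier → Set
  IsPrimitive α = ¬ (α ≈ 0#) × (pow α (order ∸ 1) ≈ 1#)
                × (∀ i → 0 ℕ.< i → i ℕ.< order ∸ 1 → ¬ (pow α i ≈ 1#))

  -- cyclotomic class C_i^d = α^i ⟨α^d⟩ = { α^(i + d k) : 0 ≤ k < (q-1)/d }, for d ∣ q-1 (d ≠ 0)
  C : Carrier → (i d : ℕ) → List Carrier
  C α i zero    = []
  C α i (suc d) = map (λ k → pow α (i ℕ.+ suc d ℕ.* k)) (upTo ((order ∸ 1) ℕ./ suc d))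

  count : Carrier → List Carrier → ℕ
  count g xs = length (filter (λ y → y ≟ g) xs)

  _∈_ : Carrier → List Carrier → Set
  g ∈ xs = Any (λ y → y ≈ g) xs

  _∉_ : Carrier → List Carrier → Set
  g ∉ xs = ¬ (g ∈ xs)

  Δ : List Carrier → List Carrier
  Δ D = concatMap (λ x → map (λ y → x - y) (filter (λ y → ¬? (x ≟ y)) D)) D
    where
    ¬? : ∀ {P : Set} → Dec P → Dec (¬ P)
    ¬? (yes p) = no (λ np → np p)
    ¬? (no np) = yes np

  Δ₂ : List Carrier → List Carrier → List Carrier
  Δ₂ D₁ D₂ = concatMap (λ x → map (λ y → x - y) D₂) D₁

  Family : ℕ → Set
  Family m = Fin m → List Carrier

  Union : ∀ {m} → Family m → List Carrier
  Union {m} D = concatMap D (allFin m)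

  InternalDiffs : ∀ {m} → Family m → List Carrier
  InternalDiffs {m} D = concatMap (λ i → Δ (D i)) (allFin m)

  ExternalDiffs : ∀ {m} → Family m → List Carrier
  ExternalDiffs {m} D =
    concatMap (λ i → concatMap (λ j → Δ₂ (D i) (D j))
                       (filter (λ j → ¬? (i Data.Fin.≟ j)) (allFin m))) (allFin m)
    where
    ¬? : ∀ {P : Set} → Dec P → Dec (¬ P)
    ¬? (yes p) = no (λ np → np p)
    ¬? (no np) = yes np

  DisjointKSubsets : ∀ {m} → Family m → ℕ → Set
  DisjointKSubsets {m} D k =
      (∀ i → length (D i) ≡ k)
    × (∀ i → All (λ x → ¬ (x ≈ 0#)) (D i))
    × (∀ i g → g ∈ D i → count g (D i) ≡ 1)
    × (∀ i j g → ¬ (i ≡ j) → g ∈ D i → g ∉ D j)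

  EqualsλSμ : List Carrier → List Carrier → ℕ → ℕ → Set
  EqualsλSμ M S λ' μ =
      (∀ g → g ≈ 0# → count g M ≡ 0)
    × (∀ g → ¬ (g ≈ 0#) → g ∈ S → count g M ≡ λ')
    × (∀ g → ¬ (g ≈ 0#) → g ∉ S → count g M ≡ μ)

  IsDisjointPDF : (m : ℕ) → Family m → ℕ → ℕ → ℕ → Set
  IsDisjointPDF m D k λ' μ = DisjointKSubsets D k × EqualsλSμ (InternalDiffs D) (Union D) λ' μ

  IsExternalPDF : (m : ℕ) → Family m → ℕ → ℕ → ℕ → Set
  IsExternalPDF m D k λ' μ = DisjointKSubsets D k × EqualsλSμ (ExternalDiffs D) (Union D) λ' μ

  IsEDF : (m : ℕ) → Family m → ℕ → ℕ → Set
  IsEDF m D k λ' = DisjointKSubsets D k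
    × (∀ g → g ≈ 0# → count g (ExternalDiffs D) ≡ 0)
    × (∀ g → ¬ (g ≈ 0#) → count g (ExternalDiffs D) ≡ λ')

  C02' : Carrier → (e : ℕ) → Family (e ℕ./ 2)
  C02' α e j = C α (2 ℕ.* Data.Fin.toℕ j) e

module Submission where

-- Write q = 4m + 1, let χ₀, χ₁ be the indicators of the squares C₀² and the non-squares C₁²,
-- and note that ν = α^e is −1, a square. Each member C_{2k}^e of the family is a pair {x, −x}
-- of squares, so the union S is C₀², the internal differences ±2x run once through 2·C₀², and
-- internal and external differences together count the pairs of squares with difference g.
-- That count is a cyclotomic number of order 2; the symmetries z ↦ −1 − z and z ↦ z⁻¹ give
-- the classical relations, whence it is m − 1 for g ∈ C₀² and m for g ∈ C₁². Finally
-- (1 + i)² = 2i for i = α^m shows that 2 is a square exactly when m is even, i.e. q ≡ 1 (mod 8).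

open import Defs
import Algebra.Properties.CommutativeMonoid.Sum as CommutativeMonoidSum
import Algebra.Properties.Group as GroupProperties
import Relation.Binary.Reasoning.Setoid
open import Data.Bool using (if_then_else_)
open import Data.Empty using (⊥-elim)
open import Data.Fin using (Fin; toℕ; fromℕ<) renaming (zero to fzero; suc to fsuc)
import Data.Fin.Properties as Finₚ
import Data.Fin.Permutation as Permutation
import Data.List.Properties
open import Data.List using (List; []; _∷_; _++_; length; filter; map; concatMap; tabulate; allFin; upTo)
open import Data.List.Relation.Unary.Any as Any using (Any; here; there)
import Data.List.Relation.Unary.Any.Properties as Anyₚ
open import Data.List.Relation.Unary.All using (All; []; _∷_)
open import Data.Nat as ℕ using (ℕ; zero; suc; _≤_; _<_; _∸_; _/_; _%_; z≤n; s≤s; NonZero)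
import Data.Nat.Properties as ℕₚ
open import Data.Nat.DivMod
open import Data.Nat.Divisibility using (_∣_; divides)
open import Data.Nat.Solver using (module +-*-Solver)
open import Data.Product using (Σ-syntax; _×_; _,_; proj₁; proj₂)
open import Data.Sum using (_⊎_; inj₁; inj₂)
open import Function using (_∘_; id; flip)
open import Relation.Binary.Core using (_Preserves_⟶_)
open import Relation.Binary.Definitions using (tri<; tri≈; tri>)
open import Relation.Nullary using (¬_; Dec; yes; no; does; ¬?)
open import Relation.Binary.PropositionalEquality as ≡ using (_≡_; refl; subst; cong; cong₂)

𝟙 : ∀ {p} {P : Set p} → Dec P → ℕ
𝟙 d = if does d then 1 else 0

𝟙-yes : ∀ {P : Set} (d : Dec P) → P → 𝟙 d ≡ 1
𝟙-yes (yes _) _ = refl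
𝟙-yes (no ¬p) p = ⊥-elim (¬p p)

𝟙-no : ∀ {P : Set} (d : Dec P) → ¬ P → 𝟙 d ≡ 0
𝟙-no (yes p) ¬p = ⊥-elim (¬p p)
𝟙-no (no _)  _  = refl

𝟙-⇔ : ∀ {P Q : Set} (d : Dec P) (d′ : Dec Q) → (P → Q) → (Q → P) → 𝟙 d ≡ 𝟙 d′
𝟙-⇔ (yes p) d′ to _    = ≡.sym (𝟙-yes d′ (to p))
𝟙-⇔ (no ¬p) d′ _  from = ≡.sym (𝟙-no d′ (¬p ∘ from))

δ : ℕ → ℕ → ℕ
δ a b = 𝟙 (a ℕ.≟ b)

∑< : ℕ → (ℕ → ℕ) → ℕ
∑< zero    f = 0
∑< (suc k) f = f 0 ℕ.+ ∑< k (f ∘ suc)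

syntax ∑< k (λ i → x) = ∑[ i < k ] x

module _ where
  open import Data.Nat using (_+_; _*_)
  open ≡.≡-Reasoning
  open +-*-Solver

  ∑<-cong : ∀ k {f g : ℕ → ℕ} → (∀ i → i < k → f i ≡ g i) → ∑< k f ≡ ∑< k g
  ∑<-cong zero    _ = refl
  ∑<-cong (suc k) h = cong₂ _+_ (h 0 (s≤s z≤n)) (∑<-cong k (λ i i<k → h (suc i) (s≤s i<k)))

  ∑<-zero : ∀ k {f : ℕ → ℕ} → (∀ i → i < k → f i ≡ 0) → ∑< k f ≡ 0
  ∑<-zero zero    _ = refl
  ∑<-zero (suc k) h = cong₂ _+_ (h 0 (s≤s z≤n)) (∑<-zero k (λ i i<k → h (suc i) (s≤s i<k)))

  ∑<-const : ∀ k c → ∑[ i < k ] c ≡ k * c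
  ∑<-const zero    c = refl
  ∑<-const (suc k) c = cong (c +_) (∑<-const k c)

  ∑<-distrib-+ : ∀ k (f g : ℕ → ℕ) → ∑[ i < k ] (f i + g i) ≡ ∑< k f + ∑< k g
  ∑<-distrib-+ zero    f g = refl
  ∑<-distrib-+ (suc k) f g = begin
    f 0 + g 0 + ∑[ i < k ] (f (suc i) + g (suc i))  ≡⟨ cong (f 0 + g 0 +_) (∑<-distrib-+ k (f ∘ suc) (g ∘ suc)) ⟩
    f 0 + g 0 + (∑< k (f ∘ suc) + ∑< k (g ∘ suc))   ≡⟨ solve 4 (λ a b c d → a :+ b :+ (c :+ d) := a :+ c :+ (b :+ d)) refl
                                                         (f 0) (g 0) (∑< k (f ∘ suc)) (∑< k (g ∘ suc)) ⟩
    f 0 + ∑< k (f ∘ suc) + (g 0 + ∑< k (g ∘ suc))   ∎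

  ∑<-+ : ∀ a b (f : ℕ → ℕ) → ∑< (a + b) f ≡ ∑< a f + ∑[ i < b ] f (a + i)
  ∑<-+ zero    b f = refl
  ∑<-+ (suc a) b f = ≡.trans (cong (f 0 +_) (∑<-+ a b (f ∘ suc))) (≡.sym (ℕₚ.+-assoc (f 0) _ _))

  ∑<-halves : ∀ m (f : ℕ → ℕ) → ∑< (m + m) f ≡ ∑[ i < m ] (f i + f (m + i))
  ∑<-halves m f = ≡.trans (∑<-+ m m f) (≡.sym (∑<-distrib-+ m f (λ i → f (m + i))))

  ∑<-evens-odds : ∀ k (f : ℕ → ℕ) → ∑< (k + k) f ≡ ∑[ t < k ] (f (t + t) + f (suc (t + t)))
  ∑<-evens-odds zero    f = refl
  ∑<-evens-odds (suc k) f = begin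
    ∑< (suc (k + suc k)) f                        ≡⟨ cong (λ j → ∑< (suc j) f) (ℕₚ.+-suc k k) ⟩
    f 0 + (f 1 + ∑< (k + k) (f ∘ suc ∘ suc))     ≡⟨ ≡.sym (ℕₚ.+-assoc (f 0) (f 1) _) ⟩
    f 0 + f 1 + ∑< (k + k) (f ∘ suc ∘ suc)       ≡⟨ cong (f 0 + f 1 +_) (∑<-evens-odds k (f ∘ suc ∘ suc)) ⟩
    f 0 + f 1 + ∑[ t < k ] (f (suc (suc (t + t))) + f (suc (suc (suc (t + t)))))
      ≡⟨ cong (f 0 + f 1 +_) (∑<-cong k (λ t _ → cong (λ j → f (suc j) + f (suc (suc j))) (≡.sym (ℕₚ.+-suc t t)))) ⟩
    f 0 + f 1 + ∑[ t < k ] (f (suc (t + suc t)) + f (suc (suc (t + suc t)))) ∎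

  ∑<-comm : ∀ a b (f : ℕ → ℕ → ℕ) → ∑[ i < a ] ∑[ j < b ] f i j ≡ ∑[ j < b ] ∑[ i < a ] f i j
  ∑<-comm zero    b f = ≡.sym (∑<-zero b (λ _ _ → refl))
  ∑<-comm (suc a) b f = ≡.trans (cong (∑< b (f 0) +_) (∑<-comm a b (f ∘ suc)))
                                (≡.sym (∑<-distrib-+ b (f 0) (λ j → ∑[ i < a ] f (suc i) j)))

  ∑<-δ : ∀ k (h : ℕ → ℕ) {j} → j < k → ∑[ i < k ] (h i * δ i j) ≡ h j
  ∑<-δ (suc k) h {zero} _ = begin
    h 0 * 1 + ∑[ i < k ] (h (suc i) * 0) ≡⟨ cong₂ _+_ (ℕₚ.*-identityʳ (h 0)) (∑<-zero k (λ i _ → ℕₚ.*-zeroʳ (h (suc i)))) ⟩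
    h 0 + 0                                ≡⟨ ℕₚ.+-identityʳ (h 0) ⟩
    h 0                                    ∎
  ∑<-δ (suc k) h {suc j} (s≤s j<k) =
    ≡.trans (cong (_+ ∑[ i < k ] (h (suc i) * δ i j)) (ℕₚ.*-zeroʳ (h 0))) (∑<-δ k (h ∘ suc) j<k)

  ∑<-removeDiagonal : ∀ k (h : ℕ → ℕ) {j} → j < k → ∑[ i < k ] (𝟙 (¬? (i ℕ.≟ j)) * h i) + h j ≡ ∑< k h
  ∑<-removeDiagonal k h {j} j<k = begin
    ∑[ i < k ] (𝟙 (¬? (i ℕ.≟ j)) * h i) + h j
      ≡⟨ cong (∑[ i < k ] (𝟙 (¬? (i ℕ.≟ j)) * h i) +_) (≡.sym (∑<-δ k h j<k)) ⟩
    ∑[ i < k ] (𝟙 (¬? (i ℕ.≟ j)) * h i) + ∑[ i < k ] (h i * δ i j)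
      ≡⟨ ≡.sym (∑<-distrib-+ k _ _) ⟩
    ∑[ i < k ] (𝟙 (¬? (i ℕ.≟ j)) * h i + h i * δ i j)
      ≡⟨ ∑<-cong k (λ i _ → complementary (i ℕ.≟ j) (h i)) ⟩
    ∑< k h ∎
    where
    complementary : ∀ {P : Set} (d : Dec P) c → 𝟙 (¬? d) * c + c * 𝟙 d ≡ c
    complementary (yes _) c = ℕₚ.*-identityʳ c
    complementary (no _)  c = ≡.trans (cong₂ _+_ (ℕₚ.*-identityˡ c) (ℕₚ.*-zeroʳ c)) (ℕₚ.+-identityʳ c)

  <-double-pred : ∀ {N k} → suc (suc k) < suc N + suc N → k < N + N
  <-double-pred {N} {k} k< = ℕₚ.≤-pred (ℕₚ.≤-pred (subst (suc (suc (suc k)) ≤_) (cong suc (ℕₚ.+-suc N N)) k<))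

  ∑<-δ-evens : ∀ N k → k < N + N → ∑[ s < N ] δ (s + s) k ≡ 1 ∸ k % 2
  ∑<-δ-evens (suc N) zero          _  = cong suc (∑<-zero N (λ _ _ → refl))
  ∑<-δ-evens (suc N) (suc zero)    _  = ∑<-zero N (λ i _ → cong (λ j → δ j 0) (ℕₚ.+-suc i i))
  ∑<-δ-evens (suc N) (suc (suc k)) k< = begin
    ∑[ s < N ] δ (s + suc s) (suc k) ≡⟨ ∑<-cong N (λ s _ → cong (λ j → δ j (suc k)) (ℕₚ.+-suc s s)) ⟩
    ∑[ s < N ] δ (s + s) k           ≡⟨ ∑<-δ-evens N k (<-double-pred k<) ⟩
    1 ∸ k % 2                        ∎

  ∑<-δ-odds : ∀ N k → k < N + N → ∑[ s < N ] δ (suc (s + s)) k ≡ k % 2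
  ∑<-δ-odds (suc N) zero          _  = ∑<-zero N (λ _ _ → refl)
  ∑<-δ-odds (suc N) (suc zero)    _  = cong suc (∑<-zero N (λ _ _ → refl))
  ∑<-δ-odds (suc N) (suc (suc k)) k< = begin
    ∑[ s < N ] δ (s + suc s) k       ≡⟨ ∑<-cong N (λ s _ → cong (λ j → δ j k) (ℕₚ.+-suc s s)) ⟩
    ∑[ s < N ] δ (suc (s + s)) k     ≡⟨ ∑<-δ-odds N k (<-double-pred k<) ⟩
    k % 2                            ∎

  even%2 : ∀ t → (t + t) % 2 ≡ 0
  even%2 zero    = refl
  even%2 (suc t) = ≡.trans (cong (λ j → suc j % 2) (ℕₚ.+-suc t t)) (even%2 t)

  odd%2 : ∀ t → suc (t + t) % 2 ≡ 1
  odd%2 zero    = refl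
  odd%2 (suc t) = ≡.trans (cong (λ j → suc (suc j) % 2) (ℕₚ.+-suc t t)) (odd%2 t)

  parity-≡ : ∀ {a b} → a ≤ 1 → b ≤ 1 → (a + b) % 2 ≡ 0 → a ≡ b
  parity-≡ z≤n       z≤n       _ = refl
  parity-≡ (s≤s z≤n) (s≤s z≤n) _ = refl
  parity-≡ z≤n       (s≤s z≤n) ()
  parity-≡ (s≤s z≤n) z≤n       ()

  1∸[1+p]%2 : ∀ {p} → p ≤ 1 → 1 ∸ (1 + p) % 2 ≡ p
  1∸[1+p]%2 z≤n       = refl
  1∸[1+p]%2 (s≤s z≤n) = refl

  *-parity : ∀ {a p} → a ≤ 1 → p ≤ 1 → a * ((p + a) % 2) ≡ a * (1 ∸ p)
  *-parity z≤n       _         = refl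
  *-parity (s≤s z≤n) z≤n       = refl
  *-parity (s≤s z≤n) (s≤s z≤n) = refl

  +-self-injective : ∀ {a b} → a + a ≡ b + b → a ≡ b
  +-self-injective {a} {b} a+a≡b+b = ℕₚ.*-cancelˡ-≡ a b 2 (begin
    2 * a    ≡⟨ cong (a +_) (ℕₚ.+-identityʳ a) ⟩
    a + a    ≡⟨ a+a≡b+b ⟩
    b + b    ≡⟨ cong (b +_) (ℕₚ.+-identityʳ b) ⟨
    2 * b    ∎)

  +-self-positive : ∀ {k} → 0 < k + k → 0 < k
  +-self-positive {suc k} _ = s≤s z≤n

  lower-or-upper-half : ∀ {m k l s} → k < m → l < m → s ≡ k ⊎ s ≡ m + k → s ≡ l ⊎ s ≡ m + l → k ≡ l
  lower-or-upper-half         _   _   (inj₁ refl) (inj₁ s≡l)  = s≡l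
  lower-or-upper-half {m} {l = l} k<m _   (inj₁ refl) (inj₂ refl) = ⊥-elim (ℕₚ.<⇒≱ k<m (ℕₚ.m≤m+n m l))
  lower-or-upper-half {m} {k} _   l<m (inj₂ refl) (inj₁ s≡l)  = ⊥-elim (ℕₚ.<⇒≱ l<m (subst (m ≤_) s≡l (ℕₚ.m≤m+n m k)))
  lower-or-upper-half {m} {k} {l} _ _ (inj₂ refl) (inj₂ s≡m+l) = ℕₚ.+-cancelˡ-≡ m k l s≡m+l

  ≤1⇒≡0⊎≡1 : ∀ {p} → p ≤ 1 → p ≡ 0 ⊎ p ≡ 1
  ≤1⇒≡0⊎≡1 z≤n       = inj₁ refl
  ≤1⇒≡0⊎≡1 (s≤s z≤n) = inj₂ refl

module ∑ = CommutativeMonoidSum ℕₚ.+-0-commutativeMonoid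

∑-toℕ : ∀ k (f : ℕ → ℕ) → ∑.sum (λ (i : Fin k) → f (toℕ i)) ≡ ∑< k f
∑-toℕ zero    f = refl
∑-toℕ (suc k) f = cong (f 0 ℕ.+_) (∑-toℕ k (f ∘ suc))

module FieldProperties (F : FiniteField) where
  open FiniteField F renaming (refl to ≈-refl; sym to ≈-sym; trans to ≈-trans)
  open import Relation.Binary.Reasoning.Setoid setoid

  infixr 8 _^_
  _^_ : Carrier → ℕ → Carrier
  _^_ = pow

  ^-homo-* : ∀ x a b → x ^ (a ℕ.+ b) ≈ x ^ a * x ^ b
  ^-homo-* x zero    b = ≈-sym (*-identityˡ (x ^ b))
  ^-homo-* x (suc a) b = ≈-trans (*-congˡ (^-homo-* x a b)) (≈-sym (*-assoc x (x ^ a) (x ^ b)))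

  _⁻¹ : Carrier → Carrier
  x ⁻¹ with x ≟ 0#
  ... | yes _   = 0#
  ... | no x≉0 = proj₁ (inverse x x≉0)

  ⁻¹-inverseʳ : ∀ {x} → x ≉ 0# → x * x ⁻¹ ≈ 1#
  ⁻¹-inverseʳ {x} x≉0 with x ≟ 0#
  ... | yes x≈0 = ⊥-elim (x≉0 x≈0)
  ... | no x≉0′ = proj₂ (inverse x x≉0′)

  ⁻¹-inverseˡ : ∀ {x} → x ≉ 0# → x ⁻¹ * x ≈ 1#
  ⁻¹-inverseˡ {x} x≉0 = ≈-trans (*-comm (x ⁻¹) x) (⁻¹-inverseʳ x≉0)

  ⁻¹-zero : ∀ {x} → x ≈ 0# → x ⁻¹ ≈ 0#
  ⁻¹-zero {x} x≈0 with x ≟ 0#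
  ... | yes _    = ≈-refl
  ... | no x≉0 = ⊥-elim (x≉0 x≈0)

  *-cancelˡ : ∀ {c a b} → c ≉ 0# → c * a ≈ c * b → a ≈ b
  *-cancelˡ {c} {a} {b} c≉0 ca≈cb = begin
    a               ≈⟨ ≈-sym (*-identityˡ a) ⟩
    1# * a          ≈⟨ *-congʳ (≈-sym (⁻¹-inverseˡ c≉0)) ⟩
    c ⁻¹ * c * a    ≈⟨ *-assoc (c ⁻¹) c a ⟩
    c ⁻¹ * (c * a)  ≈⟨ *-congˡ ca≈cb ⟩
    c ⁻¹ * (c * b)  ≈⟨ *-assoc (c ⁻¹) c b ⟨
    c ⁻¹ * c * b    ≈⟨ *-congʳ (⁻¹-inverseˡ c≉0) ⟩
    1# * b          ≈⟨ *-identityˡ b ⟩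
    b               ∎

  *-≉0 : ∀ {x y} → x ≉ 0# → y ≉ 0# → x * y ≉ 0#
  *-≉0 {x} {y} x≉0 y≉0 xy≈0 = y≉0 (*-cancelˡ x≉0 (≈-trans xy≈0 (≈-sym (zeroʳ x))))

  ⁻¹-≉0 : ∀ {x} → x ≉ 0# → x ⁻¹ ≉ 0#
  ⁻¹-≉0 {x} x≉0 x⁻¹≈0 = 0≉1 (begin
    0#          ≈⟨ zeroʳ x ⟨
    x * 0#      ≈⟨ *-congˡ x⁻¹≈0 ⟨
    x * x ⁻¹    ≈⟨ ⁻¹-inverseʳ x≉0 ⟩
    1#          ∎)

  ⁻¹-cong : ∀ {x y} → x ≈ y → x ⁻¹ ≈ y ⁻¹
  ⁻¹-cong {x} {y} x≈y = byCases (x ≟ 0#)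
    where
    byCases : Dec (x ≈ 0#) → x ⁻¹ ≈ y ⁻¹
    byCases (yes x≈0) = ≈-trans (⁻¹-zero x≈0) (≈-sym (⁻¹-zero (≈-trans (≈-sym x≈y) x≈0)))
    byCases (no x≉0)  = *-cancelˡ x≉0 (begin
      x * x ⁻¹  ≈⟨ ⁻¹-inverseʳ x≉0 ⟩
      1#        ≈⟨ ⁻¹-inverseʳ (x≉0 ∘ ≈-trans x≈y) ⟨
      y * y ⁻¹  ≈⟨ *-congʳ x≈y ⟨
      x * y ⁻¹  ∎)

  ⁻¹-involutive : ∀ x → x ⁻¹ ⁻¹ ≈ x
  ⁻¹-involutive x = byCases (x ≟ 0#)
    where
    byCases : Dec (x ≈ 0#) → x ⁻¹ ⁻¹ ≈ x
    byCases (yes x≈0) = ≈-trans (⁻¹-zero (⁻¹-zero x≈0)) (≈-sym x≈0)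
    byCases (no x≉0)  = *-cancelˡ (⁻¹-≉0 x≉0) (≈-trans (⁻¹-inverseʳ (⁻¹-≉0 x≉0)) (≈-sym (⁻¹-inverseˡ x≉0)))

  ∈⇒count>0 : ∀ {g} xs → g ∈ xs → 0 < count g xs
  ∈⇒count>0 {g} (x ∷ xs) (here x≈g) with x ≟ g
  ... | yes _    = s≤s z≤n
  ... | no x≉g = ⊥-elim (x≉g x≈g)
  ∈⇒count>0 {g} (x ∷ xs) (there g∈xs) with x ≟ g
  ... | yes _ = s≤s z≤n
  ... | no _  = ∈⇒count>0 xs g∈xs

  count>0⇒∈ : ∀ {g} xs → 0 < count g xs → g ∈ xs
  count>0⇒∈ {g} (x ∷ xs) count>0 with x ≟ g
  ... | yes x≈g = here x≈g
  ... | no _    = there (count>0⇒∈ xs count>0)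

  ∈-elements : ∀ x → x ∈ elements
  ∈-elements x = count>0⇒∈ elements (subst (0 <_) (≡.sym (enumerate x)) (s≤s z≤n))

  positionOf : Carrier → Fin order
  positionOf x = Any.index (∈-elements x)

  positionOf-injective : ∀ {x y} → positionOf x ≡ positionOf y → x ≈ y
  positionOf-injective {x} {y} eq = begin
    x                                        ≈⟨ Anyₚ.lookup-index (∈-elements x) ⟨
    Data.List.lookup elements (positionOf x) ≡⟨ cong (Data.List.lookup elements) eq ⟩
    Data.List.lookup elements (positionOf y) ≈⟨ Anyₚ.lookup-index (∈-elements y) ⟩
    y                                        ∎

  injective⇒≤order : ∀ {k} (f : Fin k → Carrier) → (∀ {i j} → f i ≈ f j → i ≡ j) → k ≤ order
  injective⇒≤order f f-injective = Finₚ.injective⇒≤ (f-injective ∘ positionOf-injective)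

  order≥2 : 2 ≤ order
  order≥2 = injective⇒≤order zeroOrOne zeroOrOne-injective
    where
    zeroOrOne : Fin 2 → Carrier
    zeroOrOne fzero    = 0#
    zeroOrOne (fsuc _) = 1#
    zeroOrOne-injective : ∀ {i j} → zeroOrOne i ≈ zeroOrOne j → i ≡ j
    zeroOrOne-injective {fzero}      {fzero}      _ = refl
    zeroOrOne-injective {fzero}      {fsuc fzero} p = ⊥-elim (0≉1 p)
    zeroOrOne-injective {fsuc fzero} {fzero}      p = ⊥-elim (0≉1 (≈-sym p))
    zeroOrOne-injective {fsuc fzero} {fsuc fzero} _ = refl

  𝟙≈-cong : ∀ {x x′ g g′} → x ≈ x′ → g ≈ g′ → 𝟙 (x ≟ g) ≡ 𝟙 (x′ ≟ g′)
  𝟙≈-cong {x} {x′} {g} {g′} x≈x′ g≈g′ = 𝟙-⇔ (x ≟ g) (x′ ≟ g′)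
    (λ x≈g → ≈-trans (≈-sym x≈x′) (≈-trans x≈g g≈g′))
    (λ x′≈g′ → ≈-trans x≈x′ (≈-trans x′≈g′ (≈-sym g≈g′)))

  count-∷ : ∀ g x xs → count g (x ∷ xs) ≡ 𝟙 (x ≟ g) ℕ.+ count g xs
  count-∷ g x xs with x ≟ g
  ... | yes _ = refl
  ... | no _  = refl

  count-++ : ∀ g xs ys → count g (xs ++ ys) ≡ count g xs ℕ.+ count g ys
  count-++ g xs ys = ≡.trans (cong length (Data.List.Properties.filter-++ (_≟ g) xs ys))
                             (Data.List.Properties.length-++ (filter (_≟ g) xs))

  count-pair : ∀ g x y → count g (x ∷ y ∷ []) ≡ 𝟙 (x ≟ g) ℕ.+ 𝟙 (y ≟ g)
  count-pair g x y = ≡.trans (count-∷ g x (y ∷ []))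
                             (cong (𝟙 (x ≟ g) ℕ.+_) (≡.trans (count-∷ g y []) (ℕₚ.+-identityʳ _)))

  count-pair-∈ : ∀ {g x y} → x ≉ y → g ∈ (x ∷ y ∷ []) → count g (x ∷ y ∷ []) ≡ 1
  count-pair-∈ {g} {x} {y} x≉y (here x≈g) = ≡.trans (count-pair g x y)
    (cong₂ ℕ._+_ (𝟙-yes (x ≟ g) x≈g) (𝟙-no (y ≟ g) (λ y≈g → x≉y (≈-trans x≈g (≈-sym y≈g)))))
  count-pair-∈ {g} {x} {y} x≉y (there (here y≈g)) = ≡.trans (count-pair g x y)
    (cong₂ ℕ._+_ (𝟙-no (x ≟ g) (λ x≈g → x≉y (≈-trans x≈g (≈-sym y≈g)))) (𝟙-yes (y ≟ g) y≈g))

  count-concatMap-tabulate :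
    ∀ {A : Set} g k (f : Fin k → A) (h : A → List Carrier) (c : ℕ → ℕ) →
    (∀ i → count g (h (f i)) ≡ c (toℕ i)) → count g (concatMap h (tabulate f)) ≡ ∑< k c
  count-concatMap-tabulate g zero    f h c _     = refl
  count-concatMap-tabulate g (suc k) f h c count≡ =
    ≡.trans (count-++ g (h (f fzero)) _)
            (cong₂ ℕ._+_ (count≡ fzero) (count-concatMap-tabulate g k (f ∘ fsuc) h (c ∘ suc) (count≡ ∘ fsuc)))

  count-concatMap-filter-tabulate :
    ∀ {A : Set} {P : A → Set} g k (f : Fin k → A) (P? : ∀ a → Dec (P a)) (h : A → List Carrier) (c : ℕ → ℕ) →
    (∀ i → 𝟙 (P? (f i)) ℕ.* count g (h (f i)) ≡ c (toℕ i)) →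
    count g (concatMap h (filter P? (tabulate f))) ≡ ∑< k c
  count-concatMap-filter-tabulate g zero    f P? h c _      = refl
  count-concatMap-filter-tabulate g (suc k) f P? h c count≡
    with P? (f fzero) | count≡ fzero
      | count-concatMap-filter-tabulate g k (f ∘ fsuc) P? h (c ∘ suc) (count≡ ∘ fsuc)
  ... | yes _ | count≡c₀ | rest = ≡.trans (count-++ g (h (f fzero)) _)
                                          (cong₂ ℕ._+_ (≡.trans (≡.sym (ℕₚ.+-identityʳ _)) count≡c₀) rest)
  ... | no _  | 0≡c₀     | rest = cong₂ ℕ._+_ 0≡c₀ rest

  count-Δ-pair : ∀ g {x y} → x ≉ y → count g (Δ (x ∷ y ∷ [])) ≡ 𝟙 ((x - y) ≟ g) ℕ.+ 𝟙 ((y - x) ≟ g)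
  count-Δ-pair g {x} {y} x≉y with x ≟ x
  ... | no x≉x = ⊥-elim (x≉x ≈-refl)
  ... | yes _ with x ≟ y
  ... | yes x≈y = ⊥-elim (x≉y x≈y)
  ... | no _ with y ≟ x
  ... | yes y≈x = ⊥-elim (x≉y (≈-sym y≈x))
  ... | no _ with y ≟ y
  ... | no y≉y = ⊥-elim (y≉y ≈-refl)
  ... | yes _ = count-pair g (x - y) (y - x)

  count-Δ₂-pair : ∀ g x₁ x₂ y₁ y₂ → count g (Δ₂ (x₁ ∷ x₂ ∷ []) (y₁ ∷ y₂ ∷ [])) ≡
    (𝟙 ((x₁ - y₁) ≟ g) ℕ.+ 𝟙 ((x₁ - y₂) ≟ g)) ℕ.+ (𝟙 ((x₂ - y₁) ≟ g) ℕ.+ 𝟙 ((x₂ - y₂) ≟ g))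
  count-Δ₂-pair g x₁ x₂ y₁ y₂ = ≡.trans (count-++ g (x₁ - y₁ ∷ x₁ - y₂ ∷ []) _)
    (cong₂ ℕ._+_ (count-pair g _ _)
                 (≡.trans (count-++ g (x₂ - y₁ ∷ x₂ - y₂ ∷ []) []) (≡.trans (ℕₚ.+-identityʳ _) (count-pair g _ _))))

  diff-cong : ∀ {x x′ y y′} → x ≈ x′ → y ≈ y′ → x - y ≈ x′ - y′
  diff-cong x≈x′ y≈y′ = +-cong x≈x′ (-‿cong y≈y′)

  𝟙-shift : ∀ x y g → 𝟙 ((x - y) ≟ g) ≡ 𝟙 (x ≟ (g + y))
  𝟙-shift x y g = 𝟙-⇔ ((x - y) ≟ g) (x ≟ (g + y))
    (λ x-y≈g → begin
      x              ≈⟨ +-identityʳ x ⟨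
      x + 0#         ≈⟨ +-congˡ (-‿inverseˡ y) ⟨
      x + (- y + y)  ≈⟨ +-assoc x (- y) y ⟨
      x - y + y      ≈⟨ +-congʳ x-y≈g ⟩
      g + y          ∎)
    (λ x≈g+y → begin
      x - y          ≈⟨ +-congʳ x≈g+y ⟩
      g + y - y      ≈⟨ +-assoc g y (- y) ⟩
      g + (y - y)    ≈⟨ +-congˡ (-‿inverseʳ y) ⟩
      g + 0#         ≈⟨ +-identityʳ g ⟩
      g              ∎)

  𝟙-scale : ∀ {c} → c ≉ 0# → ∀ x g → 𝟙 ((c * x) ≟ g) ≡ 𝟙 (x ≟ (c ⁻¹ * g))
  𝟙-scale {c} c≉0 x g = 𝟙-⇔ ((c * x) ≟ g) (x ≟ (c ⁻¹ * g))
    (λ cx≈g → *-cancelˡ c≉0 (≈-trans cx≈g (≈-sym c*c⁻¹*g≈g)))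
    (λ x≈c⁻¹g → ≈-trans (*-congˡ x≈c⁻¹g) c*c⁻¹*g≈g)
    where
    c*c⁻¹*g≈g : c * (c ⁻¹ * g) ≈ g
    c*c⁻¹*g≈g = ≈-trans (≈-sym (*-assoc c (c ⁻¹) g)) (≈-trans (*-congʳ (⁻¹-inverseʳ c≉0)) (*-identityˡ g))

  C-pair : ∀ x i e → order ∸ 1 ≡ e ℕ.+ e → C x i e ≡ x ^ i ∷ x ^ (i ℕ.+ e) ∷ []
  C-pair x i zero    order∸1≡0 = ⊥-elim (ℕₚ.<-irrefl (≡.sym order∸1≡0) (ℕₚ.∸-monoˡ-< order≥2 (s≤s z≤n)))
  C-pair x i (suc d) order∸1≡e+e = ≡.trans
    (cong (λ N → map (λ k → x ^ (i ℕ.+ suc d ℕ.* k)) (upTo N)) quotient≡2)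
    (cong₂ (λ a b → x ^ a ∷ x ^ b ∷ [])
           (≡.trans (cong (i ℕ.+_) (ℕₚ.*-zeroʳ (suc d))) (ℕₚ.+-identityʳ i))
           (cong (i ℕ.+_) (ℕₚ.*-identityʳ (suc d))))
    where
    quotient≡2 : (order ∸ 1) / suc d ≡ 2
    quotient≡2 = ≡.trans (cong (_/ suc d) (≡.trans order∸1≡e+e (cong (suc d ℕ.+_) (≡.sym (ℕₚ.+-identityʳ (suc d))))))
                         (m*n/n≡m 2 (suc d))

module PrimitiveElement (F : FiniteField) (α : FiniteField.Carrier F) (α-primitive : FiniteField.IsPrimitive F α)
                        {n : ℕ} (order≡ : FiniteField.order F ≡ suc n) where
  open FiniteField F renaming (refl to ≈-refl; sym to ≈-sym; trans to ≈-trans)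
  open FieldProperties F
  open import Relation.Binary.Reasoning.Setoid setoid

  α≉0 : α ≉ 0#
  α≉0 = proj₁ α-primitive

  α^n≈1 : α ^ n ≈ 1#
  α^n≈1 = subst (λ k → α ^ k ≈ 1#) (cong (_∸ 1) order≡) (proj₁ (proj₂ α-primitive))

  α^i≉1 : ∀ {i} → 0 < i → i < n → α ^ i ≉ 1#
  α^i≉1 0<i i<n = proj₂ (proj₂ α-primitive) _ 0<i (subst (_ <_) (cong (_∸ 1) (≡.sym order≡)) i<n)

  α^≉0 : ∀ k → α ^ k ≉ 0#
  α^≉0 zero    = 0≉1 ∘ ≈-sym
  α^≉0 (suc k) = *-≉0 α≉0 (α^≉0 k)

  0<n : 0 < n
  0<n = ℕₚ.≤-pred (subst (2 ≤_) order≡ order≥2)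

  instance
    n-nonZero : NonZero n
    n-nonZero = ℕ.>-nonZero 0<n

  α^-*n : ∀ j → α ^ (j ℕ.* n) ≈ 1#
  α^-*n zero    = ≈-refl
  α^-*n (suc j) = begin
    α ^ (n ℕ.+ j ℕ.* n)      ≈⟨ ^-homo-* α n (j ℕ.* n) ⟩
    α ^ n * α ^ (j ℕ.* n)    ≈⟨ *-cong α^n≈1 (α^-*n j) ⟩
    1# * 1#                  ≈⟨ *-identityˡ 1# ⟩
    1#                       ∎

  α^-mod : ∀ k → α ^ k ≈ α ^ (k % n)
  α^-mod k = begin
    α ^ k                              ≡⟨ cong (α ^_) (m≡m%n+[m/n]*n k n) ⟩
    α ^ (k % n ℕ.+ k / n ℕ.* n)        ≈⟨ ^-homo-* α (k % n) (k / n ℕ.* n) ⟩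
    α ^ (k % n) * α ^ (k / n ℕ.* n)    ≈⟨ *-congˡ (α^-*n (k / n)) ⟩
    α ^ (k % n) * 1#                   ≈⟨ *-identityʳ (α ^ (k % n)) ⟩
    α ^ (k % n)                        ∎

  α^-distinct : ∀ {a b} → a < b → b < n → α ^ a ≉ α ^ b
  α^-distinct {a} {b} a<b b<n α^a≈α^b =
    α^i≉1 (ℕₚ.m<n⇒0<n∸m a<b) (ℕₚ.≤-<-trans (ℕₚ.m∸n≤m b a) b<n) (≈-sym (*-cancelˡ (α^≉0 a) (begin
      α ^ a * 1#             ≈⟨ *-identityʳ (α ^ a) ⟩
      α ^ a                  ≈⟨ α^a≈α^b ⟩
      α ^ b                  ≡⟨ cong (α ^_) (ℕₚ.m+[n∸m]≡n (ℕₚ.<⇒≤ a<b)) ⟨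
      α ^ (a ℕ.+ (b ∸ a))    ≈⟨ ^-homo-* α a (b ∸ a) ⟩
      α ^ a * α ^ (b ∸ a)    ∎)))

  α^-injective : ∀ {a b} → a < n → b < n → α ^ a ≈ α ^ b → a ≡ b
  α^-injective {a} {b} a<n b<n α^a≈α^b with ℕₚ.<-cmp a b
  ... | tri< a<b _ _ = ⊥-elim (α^-distinct a<b b<n α^a≈α^b)
  ... | tri≈ _ a≡b _ = a≡b
  ... | tri> _ _ b<a = ⊥-elim (α^-distinct b<a a<n (≈-sym α^a≈α^b))

  element : Fin (suc n) → Carrier
  element fzero    = 0#
  element (fsuc i) = α ^ toℕ i

  element-injective : ∀ {i j} → element i ≈ element j → i ≡ j
  element-injective {fzero}  {fzero}  _ = refl
  element-injective {fzero}  {fsuc j} p = ⊥-elim (α^≉0 (toℕ j) (≈-sym p))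
  element-injective {fsuc i} {fzero}  p = ⊥-elim (α^≉0 (toℕ i) p)
  element-injective {fsuc i} {fsuc j} p =
    cong fsuc (Finₚ.toℕ-injective (α^-injective (Finₚ.toℕ<n i) (Finₚ.toℕ<n j) p))

  -- Otherwise x, 0, α⁰, …, α^(n−1) would be q + 1 distinct elements of the field.
  log : ∀ {x} → x ≉ 0# → Σ[ k ∈ ℕ ] k < n × α ^ k ≈ x
  log {x} x≉0 with Finₚ.any? (λ (i : Fin n) → (α ^ toℕ i) ≟ x)
  ... | yes (i , α^i≈x) = toℕ i , Finₚ.toℕ<n i , α^i≈x
  ... | no notPower =
    ⊥-elim (ℕₚ.<-irrefl refl (subst (suc (suc n) ≤_) order≡ (injective⇒≤order f f-injective)))
    where
    f : Fin (suc (suc n)) → Carrier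
    f fzero    = x
    f (fsuc i) = element i
    x≉element : ∀ i → x ≉ element i
    x≉element fzero    = x≉0
    x≉element (fsuc i) x≈α^i = notPower (i , ≈-sym x≈α^i)
    f-injective : ∀ {i j} → f i ≈ f j → i ≡ j
    f-injective {fzero}  {fzero}  _ = refl
    f-injective {fzero}  {fsuc j} p = ⊥-elim (x≉element j p)
    f-injective {fsuc i} {fzero}  p = ⊥-elim (x≉element i (≈-sym p))
    f-injective {fsuc i} {fsuc j} p = cong fsuc (element-injective p)

  index : Carrier → Fin (suc n)
  index x with x ≟ 0#
  ... | yes _   = fzero
  ... | no x≉0 = fsuc (fromℕ< (proj₁ (proj₂ (log x≉0))))

  element-index : ∀ x → element (index x) ≈ x
  element-index x with x ≟ 0#
  ... | yes x≈0 = ≈-sym x≈0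
  ... | no x≉0 = ≈-trans (reflexive (cong (α ^_) (Finₚ.toℕ-fromℕ< (proj₁ (proj₂ (log x≉0)))))) (proj₂ (proj₂ (log x≉0)))

  index-cong : ∀ {x y} → x ≈ y → index x ≡ index y
  index-cong {x} {y} x≈y = element-injective (≈-trans (element-index x) (≈-trans x≈y (≈-sym (element-index y))))

  index-element : ∀ i → index (element i) ≡ i
  index-element i = element-injective (element-index (element i))

  𝟙-α^ : ∀ {u k} → u < n → k < n → 𝟙 ((α ^ u) ≟ (α ^ k)) ≡ δ u k
  𝟙-α^ {u} {k} u<n k<n = 𝟙-⇔ ((α ^ u) ≟ (α ^ k)) (u ℕ.≟ k) (α^-injective u<n k<n) (reflexive ∘ cong (α ^_))

module FieldSum (F : FiniteField) (α : FiniteField.Carrier F) (α-primitive : FiniteField.IsPrimitive F α)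
                {n : ℕ} (order≡ : FiniteField.order F ≡ suc n) where
  open FiniteField F renaming (refl to ≈-refl; sym to ≈-sym; trans to ≈-trans)
  open FieldProperties F
  open PrimitiveElement F α α-primitive order≡
  open ≡.≡-Reasoning

  ∑𝔽 : (Carrier → ℕ) → ℕ
  ∑𝔽 f = f 0# ℕ.+ ∑[ u < n ] f (α ^ u)

  ∑𝔽-cong : ∀ {f g : Carrier → ℕ} → (∀ x → f x ≡ g x) → ∑𝔽 f ≡ ∑𝔽 g
  ∑𝔽-cong f≗g = cong₂ ℕ._+_ (f≗g 0#) (∑<-cong n (λ u _ → f≗g (α ^ u)))

  ∑𝔽-distrib-+ : ∀ (f g : Carrier → ℕ) → ∑𝔽 (λ x → f x ℕ.+ g x) ≡ ∑𝔽 f ℕ.+ ∑𝔽 g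
  ∑𝔽-distrib-+ f g = ≡.trans (cong (f 0# ℕ.+ g 0# ℕ.+_) (∑<-distrib-+ n (λ u → f (α ^ u)) (λ u → g (α ^ u))))
                              (+-*-Solver.solve 4 (λ a b c d → a :+ b :+ (c :+ d) := a :+ c :+ (b :+ d)) refl
                                                  (f 0#) (g 0#) (∑< n (λ u → f (α ^ u))) (∑< n (λ u → g (α ^ u))))
    where open +-*-Solver

  ∑𝔽-bijection : ∀ (σ τ : Carrier → Carrier) → σ Preserves _≈_ ⟶ _≈_ → τ Preserves _≈_ ⟶ _≈_ →
                 (∀ x → σ (τ x) ≈ x) → (∀ x → τ (σ x) ≈ x) →
                 ∀ f → f Preserves _≈_ ⟶ _≡_ → ∑𝔽 (f ∘ σ) ≡ ∑𝔽 f
  ∑𝔽-bijection σ τ σ-cong τ-cong στ τσ f f-cong = begin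
    ∑𝔽 (f ∘ σ)                           ≡⟨ ∑𝔽-element (f ∘ σ) ⟨
    ∑.sum (f ∘ σ ∘ element)              ≡⟨ ∑.sum-cong-≗ (λ i → f-cong (element-index (σ (element i)))) ⟨
    ∑.sum (f ∘ element ∘ index ∘ σ ∘ element)  ≡⟨ ∑.sum-permute (f ∘ element) π ⟨
    ∑.sum (f ∘ element)                  ≡⟨ ∑𝔽-element f ⟩
    ∑𝔽 f                                 ∎
    where
    ∑𝔽-element : ∀ g → ∑.sum (g ∘ element) ≡ ∑𝔽 g
    ∑𝔽-element g = cong (g 0# ℕ.+_) (∑-toℕ n (λ u → g (α ^ u)))
    π : Permutation.Permutation (suc n) (suc n)
    π = Permutation.permutation (index ∘ σ ∘ element) (index ∘ τ ∘ element)
      (λ i → ≡.trans (index-cong (σ-cong (element-index _))) (≡.trans (index-cong (στ _)) (index-element i)))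
      (λ i → ≡.trans (index-cong (τ-cong (element-index _))) (≡.trans (index-cong (τσ _)) (index-element i)))

  ∑𝔽-select : ∀ (f : Carrier → ℕ) → f Preserves _≈_ ⟶ _≡_ → ∀ c → ∑𝔽 (λ z → f z ℕ.* 𝟙 (z ≟ c)) ≡ f c
  ∑𝔽-select f f-cong c with c ≟ 0#
  ... | yes c≈0 = begin
    f 0# ℕ.* 𝟙 (0# ≟ c) ℕ.+ ∑[ u < n ] (f (α ^ u) ℕ.* 𝟙 ((α ^ u) ≟ c))
      ≡⟨ cong₂ ℕ._+_ (cong (f 0# ℕ.*_) (𝟙-yes (0# ≟ c) (≈-sym c≈0)))
                     (∑<-zero n (λ u _ → ≡.trans (cong (f (α ^ u) ℕ.*_) (𝟙-no ((α ^ u) ≟ c) (α^≉0 u ∘ flip ≈-trans c≈0)))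
                                                (ℕₚ.*-zeroʳ (f (α ^ u))))) ⟩
    f 0# ℕ.* 1 ℕ.+ 0
      ≡⟨ ≡.trans (ℕₚ.+-identityʳ _) (ℕₚ.*-identityʳ (f 0#)) ⟩
    f 0#
      ≡⟨ f-cong (≈-sym c≈0) ⟩
    f c ∎
  ... | no c≉0 with log c≉0
  ... | k , k<n , α^k≈c = begin
    f 0# ℕ.* 𝟙 (0# ≟ c) ℕ.+ ∑[ u < n ] (f (α ^ u) ℕ.* 𝟙 ((α ^ u) ≟ c))
      ≡⟨ cong₂ ℕ._+_ (≡.trans (cong (f 0# ℕ.*_) (𝟙-no (0# ≟ c) (c≉0 ∘ ≈-sym))) (ℕₚ.*-zeroʳ (f 0#)))
                     (∑<-cong n (λ u u<n → cong (f (α ^ u) ℕ.*_) (≡.trans (𝟙≈-cong ≈-refl (≈-sym α^k≈c)) (𝟙-α^ u<n k<n)))) ⟩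
    ∑[ u < n ] (f (α ^ u) ℕ.* δ u k)
      ≡⟨ ∑<-δ n (λ u → f (α ^ u)) k<n ⟩
    f (α ^ k)
      ≡⟨ f-cong α^k≈c ⟩
    f c ∎

module QuadraticCharacter (F : FiniteField) (α : FiniteField.Carrier F) (α-primitive : FiniteField.IsPrimitive F α)
                          {e : ℕ} (order≡ : FiniteField.order F ≡ suc (e ℕ.+ e)) where
  open FiniteField F renaming (refl to ≈-refl; sym to ≈-sym; trans to ≈-trans)
  open FieldProperties F
  open PrimitiveElement F α α-primitive order≡
  open FieldSum F α α-primitive order≡
  open GroupProperties +-group using (inverseʳ-unique)
  module ≈-Reasoning = Relation.Binary.Reasoning.Setoid setoid

  0<e : 0 < e
  0<e = +-self-positive 0<n

  ν : Carrier
  ν = α ^ e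

  ν*ν≈1 : ν * ν ≈ 1#
  ν*ν≈1 = ≈-trans (≈-sym (^-homo-* α e e)) α^n≈1

  ν≉1 : ν ≉ 1#
  ν≉1 = α^i≉1 0<e (ℕₚ.m<m+n e 0<e)

  1+ν≈0 : 1# + ν ≈ 0#
  1+ν≈0 with (1# + ν) ≟ 0#
  ... | yes 1+ν≈0 = 1+ν≈0
  ... | no 1+ν≉0 = ⊥-elim (ν≉1 (*-cancelˡ 1+ν≉0 (begin
    (1# + ν) * ν       ≈⟨ distribʳ ν 1# ν ⟩
    1# * ν + ν * ν     ≈⟨ +-cong (*-identityˡ ν) ν*ν≈1 ⟩
    ν + 1#             ≈⟨ +-comm ν 1# ⟩
    1# + ν             ≈⟨ *-identityʳ (1# + ν) ⟨
    (1# + ν) * 1#      ∎)))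
    where open ≈-Reasoning

  -‿≈ν* : ∀ x → - x ≈ ν * x
  -‿≈ν* x = ≈-sym (inverseʳ-unique x (ν * x) (begin
    x + ν * x          ≈⟨ +-congʳ (*-identityˡ x) ⟨
    1# * x + ν * x     ≈⟨ distribʳ x 1# ν ⟨
    (1# + ν) * x       ≈⟨ *-congʳ 1+ν≈0 ⟩
    0# * x             ≈⟨ zeroˡ x ⟩
    0#                 ∎))
    where open ≈-Reasoning

  1+x≈0⇒x≈ν : ∀ {x} → 1# + x ≈ 0# → x ≈ ν
  1+x≈0⇒x≈ν {x} 1+x≈0 = ≈-trans (inverseʳ-unique 1# x 1+x≈0) (≈-trans (-‿≈ν* 1#) (*-identityʳ ν))

  χ₀ χ₁ : Carrier → ℕ
  χ₀ x = ∑[ s < e ] 𝟙 ((α ^ (s ℕ.+ s)) ≟ x)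
  χ₁ x = ∑[ s < e ] 𝟙 ((α ^ suc (s ℕ.+ s)) ≟ x)

  χ₀-cong : χ₀ Preserves _≈_ ⟶ _≡_
  χ₀-cong x≈y = ∑<-cong e (λ _ _ → 𝟙≈-cong ≈-refl x≈y)

  χ₁-cong : χ₁ Preserves _≈_ ⟶ _≡_
  χ₁-cong x≈y = ∑<-cong e (λ _ _ → 𝟙≈-cong ≈-refl x≈y)

  χ₀-zero : ∀ {x} → x ≈ 0# → χ₀ x ≡ 0
  χ₀-zero {x} x≈0 = ∑<-zero e (λ s _ → 𝟙-no ((α ^ (s ℕ.+ s)) ≟ x) (α^≉0 (s ℕ.+ s) ∘ flip ≈-trans x≈0))

  χ₁-zero : ∀ {x} → x ≈ 0# → χ₁ x ≡ 0
  χ₁-zero {x} x≈0 = ∑<-zero e (λ s _ → 𝟙-no ((α ^ suc (s ℕ.+ s)) ≟ x) (α^≉0 (suc (s ℕ.+ s)) ∘ flip ≈-trans x≈0))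

  private
    2∣n : 2 ∣ e ℕ.+ e
    2∣n = divides e (≡.trans (cong (e ℕ.+_) (≡.sym (ℕₚ.+-identityʳ e))) (ℕₚ.*-comm 2 e))

    %n%2 : ∀ k → k % (e ℕ.+ e) % 2 ≡ k % 2
    %n%2 k = m∣n⇒o%n%m≡o%m 2 (e ℕ.+ e) k 2∣n

    2s+1<2e : ∀ {s} → s < e → suc (s ℕ.+ s) < e ℕ.+ e
    2s+1<2e {s} s<e = subst (_≤ e ℕ.+ e) (cong suc (ℕₚ.+-suc s s)) (ℕₚ.+-mono-≤ s<e s<e)

  χ₀-α^ : ∀ k → χ₀ (α ^ k) ≡ 1 ∸ k % 2
  χ₀-α^ k = begin
    χ₀ (α ^ k)                          ≡⟨ χ₀-cong (α^-mod k) ⟩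
    χ₀ (α ^ (k % n))                    ≡⟨ ∑<-cong e (λ s s<e → 𝟙-α^ (ℕₚ.+-mono-< s<e s<e) k%n<n) ⟩
    ∑[ s < e ] δ (s ℕ.+ s) (k % n)      ≡⟨ ∑<-δ-evens e (k % n) k%n<n ⟩
    1 ∸ k % n % 2                       ≡⟨ cong (1 ∸_) (%n%2 k) ⟩
    1 ∸ k % 2                           ∎
    where
    open ≡.≡-Reasoning
    n : ℕ
    n = e ℕ.+ e
    k%n<n : k % n < n
    k%n<n = m%n<n k n

  χ₁-α^ : ∀ k → χ₁ (α ^ k) ≡ k % 2
  χ₁-α^ k = begin
    χ₁ (α ^ k)                          ≡⟨ χ₁-cong (α^-mod k) ⟩
    χ₁ (α ^ (k % n))                    ≡⟨ ∑<-cong e (λ s s<e → 𝟙-α^ (2s+1<2e s<e) k%n<n) ⟩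
    ∑[ s < e ] δ (suc (s ℕ.+ s)) (k % n) ≡⟨ ∑<-δ-odds e (k % n) k%n<n ⟩
    k % n % 2                           ≡⟨ %n%2 k ⟩
    k % 2                               ∎
    where
    open ≡.≡-Reasoning
    n : ℕ
    n = e ℕ.+ e
    k%n<n : k % n < n
    k%n<n = m%n<n k n

  χ-log : ∀ {x} → x ≉ 0# → Σ[ k ∈ ℕ ] χ₀ x ≡ 1 ∸ k % 2 × χ₁ x ≡ k % 2
  χ-log x≉0 with log x≉0
  ... | k , _ , α^k≈x = k , ≡.trans (χ₀-cong (≈-sym α^k≈x)) (χ₀-α^ k) , ≡.trans (χ₁-cong (≈-sym α^k≈x)) (χ₁-α^ k)

  χ₁≤1 : ∀ x → χ₁ x ≤ 1
  χ₁≤1 x with x ≟ 0#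
  ... | yes x≈0 = subst (_≤ 1) (≡.sym (χ₁-zero x≈0)) z≤n
  ... | no x≉0 with χ-log x≉0
  ... | k , _ , χ₁x≡ = subst (_≤ 1) (≡.sym χ₁x≡) (ℕₚ.≤-pred (m%n<n k 2))

  χ₀≡1∸χ₁ : ∀ {x} → x ≉ 0# → χ₀ x ≡ 1 ∸ χ₁ x
  χ₀≡1∸χ₁ x≉0 with χ-log x≉0
  ... | k , χ₀x≡ , χ₁x≡ = ≡.trans χ₀x≡ (cong (1 ∸_) (≡.sym χ₁x≡))

  χ₁-* : ∀ {x y} → x ≉ 0# → y ≉ 0# → χ₁ (x * y) ≡ (χ₁ x ℕ.+ χ₁ y) % 2
  χ₁-* {x} {y} x≉0 y≉0 with log x≉0 | log y≉0
  ... | a , _ , α^a≈x | b , _ , α^b≈y = begin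
    χ₁ (x * y)                         ≡⟨ χ₁-cong (*-cong (≈-sym α^a≈x) (≈-sym α^b≈y)) ⟩
    χ₁ (α ^ a * α ^ b)                 ≡⟨ χ₁-cong (^-homo-* α a b) ⟨
    χ₁ (α ^ (a ℕ.+ b))                 ≡⟨ χ₁-α^ (a ℕ.+ b) ⟩
    (a ℕ.+ b) % 2                      ≡⟨ %-distribˡ-+ a b 2 ⟩
    (a % 2 ℕ.+ b % 2) % 2              ≡⟨ cong₂ (λ i j → (i ℕ.+ j) % 2) (χ₁-α^ a) (χ₁-α^ b) ⟨
    (χ₁ (α ^ a) ℕ.+ χ₁ (α ^ b)) % 2    ≡⟨ cong₂ (λ i j → (i ℕ.+ j) % 2) (χ₁-cong α^a≈x) (χ₁-cong α^b≈y) ⟩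
    (χ₁ x ℕ.+ χ₁ y) % 2                ∎
    where open ≡.≡-Reasoning

  ∑𝔽-χ₀* : ∀ (f : Carrier → ℕ) → ∑𝔽 (λ y → χ₀ y ℕ.* f y) ≡ ∑[ t < e ] f (α ^ (t ℕ.+ t))
  ∑𝔽-χ₀* f = begin
    χ₀ 0# ℕ.* f 0# ℕ.+ ∑[ u < e ℕ.+ e ] (χ₀ (α ^ u) ℕ.* f (α ^ u))
      ≡⟨ cong₂ ℕ._+_ (cong (ℕ._* f 0#) (χ₀-zero ≈-refl)) (∑<-evens-odds e (λ u → χ₀ (α ^ u) ℕ.* f (α ^ u))) ⟩
    ∑[ t < e ] (χ₀ (α ^ (t ℕ.+ t)) ℕ.* f (α ^ (t ℕ.+ t)) ℕ.+ χ₀ (α ^ suc (t ℕ.+ t)) ℕ.* f (α ^ suc (t ℕ.+ t)))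
      ≡⟨ ∑<-cong e (λ t _ → cong₂ ℕ._+_
           (cong (ℕ._* f (α ^ (t ℕ.+ t))) (≡.trans (χ₀-α^ (t ℕ.+ t)) (cong (1 ∸_) (even%2 t))))
           (cong (ℕ._* f (α ^ suc (t ℕ.+ t))) (≡.trans (χ₀-α^ (suc (t ℕ.+ t))) (cong (1 ∸_) (odd%2 t))))) ⟩
    ∑[ t < e ] (1 ℕ.* f (α ^ (t ℕ.+ t)) ℕ.+ 0)
      ≡⟨ ∑<-cong e (λ t _ → ≡.trans (ℕₚ.+-identityʳ (1 ℕ.* f (α ^ (t ℕ.+ t)))) (ℕₚ.*-identityˡ (f (α ^ (t ℕ.+ t))))) ⟩
    ∑[ t < e ] f (α ^ (t ℕ.+ t)) ∎
    where open ≡.≡-Reasoning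

  ∑𝔽-χ₀ : ∑𝔽 χ₀ ≡ e
  ∑𝔽-χ₀ = begin
    ∑𝔽 χ₀                          ≡⟨ ∑𝔽-cong (λ y → ℕₚ.*-identityʳ (χ₀ y)) ⟨
    ∑𝔽 (λ y → χ₀ y ℕ.* 1)          ≡⟨ ∑𝔽-χ₀* (λ _ → 1) ⟩
    ∑[ t < e ] 1                   ≡⟨ ∑<-const e 1 ⟩
    e ℕ.* 1                        ≡⟨ ℕₚ.*-identityʳ e ⟩
    e                              ∎
    where open ≡.≡-Reasoning

  ∑𝔽-χ₁ : ∑𝔽 χ₁ ≡ e
  ∑𝔽-χ₁ = begin
    χ₁ 0# ℕ.+ ∑[ u < e ℕ.+ e ] χ₁ (α ^ u)
      ≡⟨ cong₂ ℕ._+_ (χ₁-zero ≈-refl) (∑<-evens-odds e (χ₁ ∘ (α ^_))) ⟩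
    ∑[ t < e ] (χ₁ (α ^ (t ℕ.+ t)) ℕ.+ χ₁ (α ^ suc (t ℕ.+ t)))
      ≡⟨ ∑<-cong e (λ t _ → cong₂ ℕ._+_ (≡.trans (χ₁-α^ (t ℕ.+ t)) (even%2 t))
                                        (≡.trans (χ₁-α^ (suc (t ℕ.+ t))) (odd%2 t))) ⟩
    ∑[ t < e ] 1
      ≡⟨ ≡.trans (∑<-const e 1) (ℕₚ.*-identityʳ e) ⟩
    e ∎
    where open ≡.≡-Reasoning

  χ₁-*-square : ∀ {c} → c ≉ 0# → χ₁ c ≡ 0 → ∀ w → χ₁ (c * w) ≡ χ₁ w
  χ₁-*-square {c} c≉0 χ₁c≡0 w with w ≟ 0#
  ... | yes w≈0 = ≡.trans (χ₁-zero (≈-trans (*-congˡ w≈0) (zeroʳ c))) (≡.sym (χ₁-zero w≈0))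
  ... | no w≉0 = begin
    χ₁ (c * w)             ≡⟨ χ₁-* c≉0 w≉0 ⟩
    (χ₁ c ℕ.+ χ₁ w) % 2    ≡⟨ cong (λ i → (i ℕ.+ χ₁ w) % 2) χ₁c≡0 ⟩
    χ₁ w % 2               ≡⟨ m<n⇒m%n≡m (s≤s (χ₁≤1 w)) ⟩
    χ₁ w                   ∎
    where open ≡.≡-Reasoning

  χ₀-*-square : ∀ {c} → c ≉ 0# → χ₁ c ≡ 0 → ∀ w → χ₀ (c * w) ≡ χ₀ w
  χ₀-*-square {c} c≉0 χ₁c≡0 w with w ≟ 0#
  ... | yes w≈0 = ≡.trans (χ₀-zero (≈-trans (*-congˡ w≈0) (zeroʳ c))) (≡.sym (χ₀-zero w≈0))
  ... | no w≉0 = begin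
    χ₀ (c * w)             ≡⟨ χ₀≡1∸χ₁ (*-≉0 c≉0 w≉0) ⟩
    1 ∸ χ₁ (c * w)         ≡⟨ cong (1 ∸_) (χ₁-*-square c≉0 χ₁c≡0 w) ⟩
    1 ∸ χ₁ w               ≡⟨ χ₀≡1∸χ₁ w≉0 ⟨
    χ₀ w                   ∎
    where open ≡.≡-Reasoning

  χ₀-*-nonsquare : ∀ {c} → c ≉ 0# → χ₁ c ≡ 1 → ∀ w → χ₀ (c * w) ≡ χ₁ w
  χ₀-*-nonsquare {c} c≉0 χ₁c≡1 w with w ≟ 0#
  ... | yes w≈0 = ≡.trans (χ₀-zero (≈-trans (*-congˡ w≈0) (zeroʳ c))) (≡.sym (χ₁-zero w≈0))
  ... | no w≉0 = begin
    χ₀ (c * w)                   ≡⟨ χ₀≡1∸χ₁ (*-≉0 c≉0 w≉0) ⟩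
    1 ∸ χ₁ (c * w)               ≡⟨ cong (1 ∸_) (χ₁-* c≉0 w≉0) ⟩
    1 ∸ (χ₁ c ℕ.+ χ₁ w) % 2      ≡⟨ cong (λ i → 1 ∸ (i ℕ.+ χ₁ w) % 2) χ₁c≡1 ⟩
    1 ∸ (1 ℕ.+ χ₁ w) % 2         ≡⟨ 1∸[1+p]%2 (χ₁≤1 w) ⟩
    χ₁ w                         ∎
    where open ≡.≡-Reasoning

  χ₁-⁻¹ : ∀ {x} → x ≉ 0# → χ₁ (x ⁻¹) ≡ χ₁ x
  χ₁-⁻¹ {x} x≉0 = ≡.sym (parity-≡ (χ₁≤1 x) (χ₁≤1 (x ⁻¹)) (begin
    (χ₁ x ℕ.+ χ₁ (x ⁻¹)) % 2    ≡⟨ χ₁-* x≉0 (⁻¹-≉0 x≉0) ⟨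
    χ₁ (x * x ⁻¹)               ≡⟨ χ₁-cong (⁻¹-inverseʳ x≉0) ⟩
    χ₁ (α ^ 0)                  ≡⟨ χ₁-α^ 0 ⟩
    0                           ∎))
    where open ≡.≡-Reasoning

module CyclotomicNumbers (F : FiniteField) (α : FiniteField.Carrier F) (α-primitive : FiniteField.IsPrimitive F α)
                         {m : ℕ} (order≡ : FiniteField.order F ≡ suc ((m ℕ.+ m) ℕ.+ (m ℕ.+ m))) where
  open FiniteField F renaming (refl to ≈-refl; sym to ≈-sym; trans to ≈-trans)
  open FieldProperties F
  open PrimitiveElement F α α-primitive order≡
  open FieldSum F α α-primitive order≡
  open QuadraticCharacter F α α-primitive {m ℕ.+ m} order≡

  χ₀-ν : χ₀ ν ≡ 1
  χ₀-ν = ≡.trans (χ₀-α^ (m ℕ.+ m)) (cong (1 ∸_) (even%2 m))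

  χ₁-ν : χ₁ ν ≡ 0
  χ₁-ν = ≡.trans (χ₁-α^ (m ℕ.+ m)) (even%2 m)

  cyc : (Carrier → ℕ) → (Carrier → ℕ) → ℕ
  cyc χ χ′ = ∑𝔽 (λ z → χ z ℕ.* χ′ (1# + z))

  ∑𝔽-split-1+z : ∀ χ → χ Preserves _≈_ ⟶ _≡_ → ∑𝔽 χ ≡ cyc χ χ₀ ℕ.+ cyc χ χ₁ ℕ.+ χ ν
  ∑𝔽-split-1+z χ χ-cong = begin
    ∑𝔽 χ
      ≡⟨ ∑𝔽-cong (λ z → ≡.trans (≡.sym (ℕₚ.*-identityʳ (χ z))) (cong (χ z ℕ.*_) (≡.sym (partition z)))) ⟩
    ∑𝔽 (λ z → χ z ℕ.* (χ₀ (1# + z) ℕ.+ χ₁ (1# + z) ℕ.+ 𝟙 (z ≟ ν)))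
      ≡⟨ ∑𝔽-cong (λ z → solve 4 (λ x a b c → x :* (a :+ b :+ c) := x :* a :+ x :* b :+ x :* c) refl
                                   (χ z) (χ₀ (1# + z)) (χ₁ (1# + z)) (𝟙 (z ≟ ν))) ⟩
    ∑𝔽 (λ z → χ z ℕ.* χ₀ (1# + z) ℕ.+ χ z ℕ.* χ₁ (1# + z) ℕ.+ χ z ℕ.* 𝟙 (z ≟ ν))
      ≡⟨ ∑𝔽-distrib-+ (λ z → χ z ℕ.* χ₀ (1# + z) ℕ.+ χ z ℕ.* χ₁ (1# + z)) (λ z → χ z ℕ.* 𝟙 (z ≟ ν)) ⟩
    ∑𝔽 (λ z → χ z ℕ.* χ₀ (1# + z) ℕ.+ χ z ℕ.* χ₁ (1# + z)) ℕ.+ ∑𝔽 (λ z → χ z ℕ.* 𝟙 (z ≟ ν))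
      ≡⟨ cong₂ ℕ._+_ (∑𝔽-distrib-+ (λ z → χ z ℕ.* χ₀ (1# + z)) (λ z → χ z ℕ.* χ₁ (1# + z)))
                     (∑𝔽-select χ χ-cong ν) ⟩
    cyc χ χ₀ ℕ.+ cyc χ χ₁ ℕ.+ χ ν ∎
    where
    open ≡.≡-Reasoning
    open +-*-Solver
    partition : ∀ z → χ₀ (1# + z) ℕ.+ χ₁ (1# + z) ℕ.+ 𝟙 (z ≟ ν) ≡ 1
    partition z with (1# + z) ≟ 0#
    ... | yes 1+z≈0 = cong₂ ℕ._+_ (cong₂ ℕ._+_ (χ₀-zero 1+z≈0) (χ₁-zero 1+z≈0))
                                  (𝟙-yes (z ≟ ν) (1+x≈0⇒x≈ν 1+z≈0))
    ... | no 1+z≉0 = cong₂ ℕ._+_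
      (≡.trans (cong (ℕ._+ χ₁ (1# + z)) (χ₀≡1∸χ₁ 1+z≉0)) (ℕₚ.m∸n+n≡m (χ₁≤1 (1# + z))))
      (𝟙-no (z ≟ ν) (λ z≈ν → 1+z≉0 (≈-trans (+-congˡ z≈ν) 1+ν≈0)))

  cyc₀₀+cyc₀₁+1 : cyc χ₀ χ₀ ℕ.+ cyc χ₀ χ₁ ℕ.+ 1 ≡ m ℕ.+ m
  cyc₀₀+cyc₀₁+1 = ≡.trans (cong (cyc χ₀ χ₀ ℕ.+ cyc χ₀ χ₁ ℕ.+_) (≡.sym χ₀-ν))
                          (≡.trans (≡.sym (∑𝔽-split-1+z χ₀ χ₀-cong)) ∑𝔽-χ₀)

  cyc₁₀+cyc₁₁ : cyc χ₁ χ₀ ℕ.+ cyc χ₁ χ₁ ≡ m ℕ.+ m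
  cyc₁₀+cyc₁₁ = ≡.trans (≡.sym (ℕₚ.+-identityʳ _))
                        (≡.trans (cong (cyc χ₁ χ₀ ℕ.+ cyc χ₁ χ₁ ℕ.+_) (≡.sym χ₁-ν))
                                 (≡.trans (≡.sym (∑𝔽-split-1+z χ₁ χ₁-cong)) ∑𝔽-χ₁))

  private
    χχ′-cong : ∀ χ χ′ → χ Preserves _≈_ ⟶ _≡_ → χ′ Preserves _≈_ ⟶ _≡_ →
               (λ z → χ z ℕ.* χ′ (1# + z)) Preserves _≈_ ⟶ _≡_
    χχ′-cong χ χ′ χ-cong χ′-cong x≈y = cong₂ ℕ._*_ (χ-cong x≈y) (χ′-cong (+-congˡ x≈y))

  -- z ↦ −1 − z exchanges the conditions "z ∈ C₀², 1 + z ∈ C₁²" and "z ∈ C₁², 1 + z ∈ C₀²".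
  cyc₀₁≡cyc₁₀ : cyc χ₀ χ₁ ≡ cyc χ₁ χ₀
  cyc₀₁≡cyc₁₀ = ≡.trans
    (≡.sym (∑𝔽-bijection σ σ σ-cong σ-cong σ-involutive σ-involutive _ (χχ′-cong χ₀ χ₁ χ₀-cong χ₁-cong)))
    (∑𝔽-cong swap)
    where
    σ : Carrier → Carrier
    σ z = ν + ν * z
    σ-cong : σ Preserves _≈_ ⟶ _≈_
    σ-cong z≈z′ = +-congˡ (*-congˡ z≈z′)
    σ-involutive : ∀ z → σ (σ z) ≈ z
    σ-involutive z = begin
      ν + ν * (ν + ν * z)          ≈⟨ +-congˡ (distribˡ ν ν (ν * z)) ⟩
      ν + (ν * ν + ν * (ν * z))    ≈⟨ +-congˡ (+-congˡ (*-assoc ν ν z)) ⟨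
      ν + (ν * ν + ν * ν * z)      ≈⟨ +-congˡ (+-cong ν*ν≈1 (≈-trans (*-congʳ ν*ν≈1) (*-identityˡ z))) ⟩
      ν + (1# + z)                 ≈⟨ +-assoc ν 1# z ⟨
      ν + 1# + z                   ≈⟨ +-congʳ (≈-trans (+-comm ν 1#) 1+ν≈0) ⟩
      0# + z                       ≈⟨ +-identityˡ z ⟩
      z                            ∎
      where open ≈-Reasoning
    σ≈ν*[1+z] : ∀ z → σ z ≈ ν * (1# + z)
    σ≈ν*[1+z] z = ≈-trans (+-congʳ (≈-sym (*-identityʳ ν))) (≈-sym (distribˡ ν 1# z))
    1+σ≈ν*z : ∀ z → 1# + σ z ≈ ν * z
    1+σ≈ν*z z = ≈-trans (≈-sym (+-assoc 1# ν (ν * z))) (≈-trans (+-congʳ 1+ν≈0) (+-identityˡ (ν * z)))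
    swap : ∀ z → χ₀ (σ z) ℕ.* χ₁ (1# + σ z) ≡ χ₁ z ℕ.* χ₀ (1# + z)
    swap z = ≡.trans (cong₂ ℕ._*_ (≡.trans (χ₀-cong (σ≈ν*[1+z] z)) (χ₀-*-square (α^≉0 (m ℕ.+ m)) χ₁-ν (1# + z)))
                                  (≡.trans (χ₁-cong (1+σ≈ν*z z)) (χ₁-*-square (α^≉0 (m ℕ.+ m)) χ₁-ν z)))
                     (ℕₚ.*-comm (χ₀ (1# + z)) (χ₁ z))

  -- Inversion z ↦ z⁻¹ maps 1 + z to (1 + z) z⁻¹, which for z ∈ C₁² flips the class of 1 + z.
  cyc₁₁≡cyc₁₀ : cyc χ₁ χ₁ ≡ cyc χ₁ χ₀
  cyc₁₁≡cyc₁₀ = ≡.trans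
    (≡.sym (∑𝔽-bijection _⁻¹ _⁻¹ ⁻¹-cong ⁻¹-cong ⁻¹-involutive ⁻¹-involutive _ (χχ′-cong χ₁ χ₁ χ₁-cong χ₁-cong)))
    (∑𝔽-cong invert)
    where
    invert : ∀ z → χ₁ (z ⁻¹) ℕ.* χ₁ (1# + z ⁻¹) ≡ χ₁ z ℕ.* χ₀ (1# + z)
    invert z = byCases (z ≟ 0#) ((1# + z) ≟ 0#)
      where
      open ≡.≡-Reasoning
      [1+z]z⁻¹≈1+z⁻¹ : z ≉ 0# → (1# + z) * z ⁻¹ ≈ 1# + z ⁻¹
      [1+z]z⁻¹≈1+z⁻¹ z≉0 = ≈-trans (distribʳ (z ⁻¹) 1# z)
                           (≈-trans (+-cong (*-identityˡ (z ⁻¹)) (⁻¹-inverseʳ z≉0)) (+-comm (z ⁻¹) 1#))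
      byCases : Dec (z ≈ 0#) → Dec ((1# + z) ≈ 0#) → χ₁ (z ⁻¹) ℕ.* χ₁ (1# + z ⁻¹) ≡ χ₁ z ℕ.* χ₀ (1# + z)
      byCases (yes z≈0) _ = begin
        χ₁ (z ⁻¹) ℕ.* χ₁ (1# + z ⁻¹)     ≡⟨ cong (ℕ._* χ₁ (1# + z ⁻¹)) (χ₁-zero (⁻¹-zero z≈0)) ⟩
        0                                ≡⟨ cong (ℕ._* χ₀ (1# + z)) (χ₁-zero z≈0) ⟨
        χ₁ z ℕ.* χ₀ (1# + z)             ∎
      byCases (no z≉0) (yes 1+z≈0) = begin
        χ₁ (z ⁻¹) ℕ.* χ₁ (1# + z ⁻¹)     ≡⟨ cong (χ₁ (z ⁻¹) ℕ.*_) (χ₁-zero 1+z⁻¹≈0) ⟩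
        χ₁ (z ⁻¹) ℕ.* 0                  ≡⟨ ℕₚ.*-zeroʳ (χ₁ (z ⁻¹)) ⟩
        0                                ≡⟨ ℕₚ.*-zeroʳ (χ₁ z) ⟨
        χ₁ z ℕ.* 0                       ≡⟨ cong (χ₁ z ℕ.*_) (χ₀-zero 1+z≈0) ⟨
        χ₁ z ℕ.* χ₀ (1# + z)             ∎
        where
        1+z⁻¹≈0 : 1# + z ⁻¹ ≈ 0#
        1+z⁻¹≈0 = ≈-trans (≈-sym ([1+z]z⁻¹≈1+z⁻¹ z≉0)) (≈-trans (*-congʳ 1+z≈0) (zeroˡ (z ⁻¹)))
      byCases (no z≉0) (no 1+z≉0) = begin
        χ₁ (z ⁻¹) ℕ.* χ₁ (1# + z ⁻¹)                  ≡⟨ cong₂ ℕ._*_ (χ₁-⁻¹ z≉0) (χ₁-cong (≈-sym ([1+z]z⁻¹≈1+z⁻¹ z≉0))) ⟩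
        χ₁ z ℕ.* χ₁ ((1# + z) * z ⁻¹)                 ≡⟨ cong (χ₁ z ℕ.*_) (χ₁-* 1+z≉0 (⁻¹-≉0 z≉0)) ⟩
        χ₁ z ℕ.* ((χ₁ (1# + z) ℕ.+ χ₁ (z ⁻¹)) % 2)    ≡⟨ cong (λ i → χ₁ z ℕ.* ((χ₁ (1# + z) ℕ.+ i) % 2)) (χ₁-⁻¹ z≉0) ⟩
        χ₁ z ℕ.* ((χ₁ (1# + z) ℕ.+ χ₁ z) % 2)         ≡⟨ *-parity (χ₁≤1 z) (χ₁≤1 (1# + z)) ⟩
        χ₁ z ℕ.* (1 ∸ χ₁ (1# + z))                    ≡⟨ cong (χ₁ z ℕ.*_) (χ₀≡1∸χ₁ 1+z≉0) ⟨
        χ₁ z ℕ.* χ₀ (1# + z)                          ∎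

  cyc₀₁≡m : cyc χ₀ χ₁ ≡ m
  cyc₀₁≡m = +-self-injective (begin
    cyc χ₀ χ₁ ℕ.+ cyc χ₀ χ₁    ≡⟨ cong₂ ℕ._+_ cyc₀₁≡cyc₁₀ (≡.trans cyc₀₁≡cyc₁₀ (≡.sym cyc₁₁≡cyc₁₀)) ⟩
    cyc χ₁ χ₀ ℕ.+ cyc χ₁ χ₁    ≡⟨ cyc₁₀+cyc₁₁ ⟩
    m ℕ.+ m                    ∎)
    where open ≡.≡-Reasoning

  cyc₀₀≡m∸1 : cyc χ₀ χ₀ ≡ m ∸ 1
  cyc₀₀≡m∸1 = ≡.trans (≡.sym (ℕₚ.m+n∸n≡m (cyc χ₀ χ₀) 1)) (cong (_∸ 1) (ℕₚ.+-cancelʳ-≡ m _ _ (begin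
    cyc χ₀ χ₀ ℕ.+ 1 ℕ.+ m          ≡⟨ ℕₚ.+-assoc (cyc χ₀ χ₀) 1 m ⟩
    cyc χ₀ χ₀ ℕ.+ (1 ℕ.+ m)        ≡⟨ cong (cyc χ₀ χ₀ ℕ.+_) (ℕₚ.+-comm 1 m) ⟩
    cyc χ₀ χ₀ ℕ.+ (m ℕ.+ 1)        ≡⟨ ℕₚ.+-assoc (cyc χ₀ χ₀) m 1 ⟨
    cyc χ₀ χ₀ ℕ.+ m ℕ.+ 1          ≡⟨ cong (λ c → cyc χ₀ χ₀ ℕ.+ c ℕ.+ 1) cyc₀₁≡m ⟨
    cyc χ₀ χ₀ ℕ.+ cyc χ₀ χ₁ ℕ.+ 1  ≡⟨ cyc₀₀+cyc₀₁+1 ⟩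
    m ℕ.+ m                        ∎)))
    where open ≡.≡-Reasoning

  squarePairs : Carrier → ℕ
  squarePairs g = ∑𝔽 (λ y → χ₀ y ℕ.* χ₀ (g + y))

  squarePairs-scaled : ∀ {g} → g ≉ 0# → squarePairs g ≡ ∑𝔽 (λ z → χ₀ (g * z) ℕ.* χ₀ (g * (1# + z)))
  squarePairs-scaled {g} g≉0 = ≡.trans
    (≡.sym (∑𝔽-bijection (g *_) (g ⁻¹ *_) *-congˡ *-congˡ g*g⁻¹* g⁻¹*g* _
                         (λ y≈y′ → cong₂ ℕ._*_ (χ₀-cong y≈y′) (χ₀-cong (+-congˡ y≈y′)))))
    (∑𝔽-cong (λ z → cong (χ₀ (g * z) ℕ.*_) (χ₀-cong (g+gz≈g[1+z] z))))
    where
    g*g⁻¹* : ∀ z → g * (g ⁻¹ * z) ≈ z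
    g*g⁻¹* z = ≈-trans (≈-sym (*-assoc g (g ⁻¹) z)) (≈-trans (*-congʳ (⁻¹-inverseʳ g≉0)) (*-identityˡ z))
    g⁻¹*g* : ∀ z → g ⁻¹ * (g * z) ≈ z
    g⁻¹*g* z = ≈-trans (≈-sym (*-assoc (g ⁻¹) g z)) (≈-trans (*-congʳ (⁻¹-inverseˡ g≉0)) (*-identityˡ z))
    g+gz≈g[1+z] : ∀ z → g + g * z ≈ g * (1# + z)
    g+gz≈g[1+z] z = ≈-trans (+-congʳ (≈-sym (*-identityʳ g))) (≈-sym (distribˡ g 1# z))

  squarePairs-square : ∀ {g} → g ≉ 0# → χ₁ g ≡ 0 → squarePairs g ≡ m ∸ 1
  squarePairs-square {g} g≉0 χ₁g≡0 = ≡.trans (squarePairs-scaled g≉0)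
    (≡.trans (∑𝔽-cong (λ z → cong₂ ℕ._*_ (χ₀-*-square g≉0 χ₁g≡0 z) (χ₀-*-square g≉0 χ₁g≡0 (1# + z))))
             cyc₀₀≡m∸1)

  squarePairs-nonsquare : ∀ {g} → g ≉ 0# → χ₁ g ≡ 1 → squarePairs g ≡ m
  squarePairs-nonsquare {g} g≉0 χ₁g≡1 = ≡.trans (squarePairs-scaled g≉0)
    (≡.trans (∑𝔽-cong (λ z → cong₂ ℕ._*_ (χ₀-*-nonsquare g≉0 χ₁g≡1 z) (χ₀-*-nonsquare g≉0 χ₁g≡1 (1# + z))))
             (≡.trans cyc₁₁≡cyc₁₀ (≡.trans (≡.sym cyc₀₁≡cyc₁₀) cyc₀₁≡m)))

  two : Carrier
  two = 1# + 1#

  two≉0 : two ≉ 0#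
  two≉0 1+1≈0 = ν≉1 (≈-sym (1+x≈0⇒x≈ν 1+1≈0))

  -- With i = α^m we have i² = −1, so (1 + i)² = 2i: the element 2 lies in the class of i.
  χ₁-two : χ₁ two ≡ m % 2
  χ₁-two = ≡.trans (≡.sym (parity-≡ (χ₁≤1 i) (χ₁≤1 two) i·two-even)) (χ₁-α^ m)
    where
    open import Algebra.Solver.Ring.NaturalCoefficients.Default commutativeSemiring
      using (solve; _:=_; _:+_; _:*_; con)
    i : Carrier
    i = α ^ m
    i*i≈ν : i * i ≈ ν
    i*i≈ν = ≈-sym (^-homo-* α m m)
    m<m+m : m < m ℕ.+ m
    m<m+m = ℕₚ.m<m+n m (+-self-positive 0<e)
    m+m<n : m ℕ.+ m < (m ℕ.+ m) ℕ.+ (m ℕ.+ m)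
    m+m<n = ℕₚ.m<m+n (m ℕ.+ m) 0<e
    1+i≉0 : 1# + i ≉ 0#
    1+i≉0 1+i≈0 = ℕₚ.<-irrefl (α^-injective (ℕₚ.<-trans m<m+m m+m<n) m+m<n (1+x≈0⇒x≈ν 1+i≈0)) m<m+m
    [1+i]²≈two*i : (1# + i) * (1# + i) ≈ two * i
    [1+i]²≈two*i = begin
      (1# + i) * (1# + i)      ≈⟨ solve 1 (λ x → (con 1 :+ x) :* (con 1 :+ x) := (con 1 :+ x :* x) :+ (con 1 :+ con 1) :* x) ≈-refl i ⟩
      (1# + i * i) + two * i   ≈⟨ +-congʳ (≈-trans (+-congˡ i*i≈ν) 1+ν≈0) ⟩
      0# + two * i             ≈⟨ +-identityˡ (two * i) ⟩
      two * i                  ∎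
      where open ≈-Reasoning
    i·two-even : (χ₁ i ℕ.+ χ₁ two) % 2 ≡ 0
    i·two-even = begin
      (χ₁ i ℕ.+ χ₁ two) % 2                ≡⟨ cong (_% 2) (ℕₚ.+-comm (χ₁ i) (χ₁ two)) ⟩
      (χ₁ two ℕ.+ χ₁ i) % 2                ≡⟨ χ₁-* two≉0 (α^≉0 m) ⟨
      χ₁ (two * i)                         ≡⟨ χ₁-cong [1+i]²≈two*i ⟨
      χ₁ ((1# + i) * (1# + i))             ≡⟨ χ₁-* 1+i≉0 1+i≉0 ⟩
      (χ₁ (1# + i) ℕ.+ χ₁ (1# + i)) % 2    ≡⟨ even%2 (χ₁ (1# + i)) ⟩
      0                                    ∎
      where open ≡.≡-Reasoning

module C02'Family (F : FiniteField) (α : FiniteField.Carrier F) (α-primitive : FiniteField.IsPrimitive F α)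
                  {e m : ℕ} (e≡m+m : e ≡ m ℕ.+ m) (order≡ : FiniteField.order F ≡ suc (e ℕ.+ e)) where
  open FiniteField F renaming (refl to ≈-refl; sym to ≈-sym; trans to ≈-trans)
  open FieldProperties F

  private
    order≡′ : order ≡ suc ((m ℕ.+ m) ℕ.+ (m ℕ.+ m))
    order≡′ = subst (λ k → order ≡ suc (k ℕ.+ k)) e≡m+m order≡

  open PrimitiveElement F α α-primitive order≡′
  open FieldSum F α α-primitive order≡′
  open QuadraticCharacter F α α-primitive {m ℕ.+ m} order≡′
  open CyclotomicNumbers F α α-primitive {m} order≡′

  D : Family (e / 2)
  D = C02' α e

  e/2≡m : e / 2 ≡ m
  e/2≡m = ≡.trans (cong (_/ 2) (≡.trans e≡m+m (cong (m ℕ.+_) (≡.sym (ℕₚ.+-identityʳ m)))))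
                  (≡.trans (cong (_/ 2) (ℕₚ.*-comm 2 m)) (m*n/n≡m m 2))

  -- C₂ₖ k = {a k, b k} with b k = −a k, and a 0, …, a (2m − 1) enumerate the squares.
  a b : ℕ → Carrier
  a k = α ^ (k ℕ.+ k)
  b k = a (m ℕ.+ k)

  C₂ₖ : ℕ → List Carrier
  C₂ₖ k = C α (2 ℕ.* k) e

  C₂ₖ≡ : ∀ k → C₂ₖ k ≡ α ^ (2 ℕ.* k) ∷ α ^ (2 ℕ.* k ℕ.+ e) ∷ []
  C₂ₖ≡ k = C-pair α (2 ℕ.* k) e (cong (_∸ 1) order≡)

  α^2k≈a : ∀ k → α ^ (2 ℕ.* k) ≈ a k
  α^2k≈a k = reflexive (cong (α ^_) (cong (k ℕ.+_) (ℕₚ.+-identityʳ k)))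

  α^[2k+e]≈b : ∀ k → α ^ (2 ℕ.* k ℕ.+ e) ≈ b k
  α^[2k+e]≈b k = reflexive (cong (α ^_) (≡.trans (cong (2 ℕ.* k ℕ.+_) e≡m+m)
    (solve 2 (λ k m → con 2 :* k :+ (m :+ m) := (m :+ k) :+ (m :+ k)) refl k m)))
    where open +-*-Solver

  b≈ν*a : ∀ k → b k ≈ ν * a k
  b≈ν*a k = ≈-trans (reflexive (cong (α ^_) (solve 2 (λ k m → (m :+ k) :+ (m :+ k) := (m :+ m) :+ (k :+ k)) refl k m)))
                    (^-homo-* α (m ℕ.+ m) (k ℕ.+ k))
    where open +-*-Solver

  a≉b : ∀ k → a k ≉ b k
  a≉b k a≈b = ν≉1 (≈-sym (*-cancelˡ (α^≉0 (k ℕ.+ k)) (begin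
    a k * 1#    ≈⟨ *-identityʳ (a k) ⟩
    a k         ≈⟨ a≈b ⟩
    b k         ≈⟨ b≈ν*a k ⟩
    ν * a k     ≈⟨ *-comm ν (a k) ⟩
    a k * ν     ∎)))
    where open ≈-Reasoning

  x+x≈two*x : ∀ x → x + x ≈ two * x
  x+x≈two*x x = ≈-sym (≈-trans (distribʳ x 1# 1#) (+-cong (*-identityˡ x) (*-identityˡ x)))

  a-b≈two*a : ∀ k → a k - b k ≈ two * a k
  a-b≈two*a k = begin
    a k - b k             ≈⟨ +-congˡ (-‿≈ν* (b k)) ⟩
    a k + ν * b k         ≈⟨ +-congˡ (*-congˡ (b≈ν*a k)) ⟩
    a k + ν * (ν * a k)   ≈⟨ +-congˡ (≈-trans (≈-sym (*-assoc ν ν (a k))) (≈-trans (*-congʳ ν*ν≈1) (*-identityˡ (a k)))) ⟩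
    a k + a k             ≈⟨ x+x≈two*x (a k) ⟩
    two * a k             ∎
    where open ≈-Reasoning

  b-a≈two*b : ∀ k → b k - a k ≈ two * b k
  b-a≈two*b k = begin
    b k - a k             ≈⟨ +-congˡ (-‿≈ν* (a k)) ⟩
    b k + ν * a k         ≈⟨ +-congˡ (b≈ν*a k) ⟨
    b k + b k             ≈⟨ x+x≈two*x (b k) ⟩
    two * b k             ∎
    where open ≈-Reasoning

  count-C₂ₖ : ∀ g k → count g (C₂ₖ k) ≡ 𝟙 (a k ≟ g) ℕ.+ 𝟙 (b k ≟ g)
  count-C₂ₖ g k = ≡.trans (cong (count g) (C₂ₖ≡ k))
    (≡.trans (count-pair g _ _) (cong₂ ℕ._+_ (𝟙≈-cong (α^2k≈a k) ≈-refl) (𝟙≈-cong (α^[2k+e]≈b k) ≈-refl)))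

  count-Δ-C₂ₖ : ∀ g k → count g (Δ (C₂ₖ k)) ≡ 𝟙 ((a k - b k) ≟ g) ℕ.+ 𝟙 ((b k - a k) ≟ g)
  count-Δ-C₂ₖ g k = ≡.trans (cong (count g ∘ Δ) (C₂ₖ≡ k))
    (≡.trans (count-Δ-pair g (λ p → a≉b k (≈-trans (≈-sym (α^2k≈a k)) (≈-trans p (α^[2k+e]≈b k)))))
             (cong₂ ℕ._+_ (𝟙≈-cong (diff-cong (α^2k≈a k) (α^[2k+e]≈b k)) ≈-refl)
                          (𝟙≈-cong (diff-cong (α^[2k+e]≈b k) (α^2k≈a k)) ≈-refl)))

  count-Δ₂-C₂ₖ : ∀ g k l → count g (Δ₂ (C₂ₖ k) (C₂ₖ l)) ≡
    (𝟙 ((a k - a l) ≟ g) ℕ.+ 𝟙 ((a k - b l) ≟ g)) ℕ.+ (𝟙 ((b k - a l) ≟ g) ℕ.+ 𝟙 ((b k - b l) ≟ g))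
  count-Δ₂-C₂ₖ g k l = ≡.trans (cong₂ (λ xs ys → count g (Δ₂ xs ys)) (C₂ₖ≡ k) (C₂ₖ≡ l))
    (≡.trans (count-Δ₂-pair g _ _ _ _)
      (cong₂ ℕ._+_ (cong₂ ℕ._+_ (𝟙≈-cong (diff-cong (α^2k≈a k) (α^2k≈a l)) ≈-refl)
                                (𝟙≈-cong (diff-cong (α^2k≈a k) (α^[2k+e]≈b l)) ≈-refl))
                   (cong₂ ℕ._+_ (𝟙≈-cong (diff-cong (α^[2k+e]≈b k) (α^2k≈a l)) ≈-refl)
                                (𝟙≈-cong (diff-cong (α^[2k+e]≈b k) (α^[2k+e]≈b l)) ≈-refl))))

  ∑-over-classes : ∀ (f : ℕ → ℕ) → ∑< (e / 2) f ≡ ∑< m f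
  ∑-over-classes f = cong (λ N → ∑< N f) e/2≡m

  count-Union : ∀ g → count g (Union D) ≡ χ₀ g
  count-Union g = begin
    count g (Union D)                              ≡⟨ count-concatMap-tabulate g (e / 2) id D (λ k → count g (C₂ₖ k)) (λ _ → refl) ⟩
    ∑< (e / 2) (λ k → count g (C₂ₖ k))             ≡⟨ ∑-over-classes _ ⟩
    ∑[ k < m ] count g (C₂ₖ k)                     ≡⟨ ∑<-cong m (λ k _ → count-C₂ₖ g k) ⟩
    ∑[ k < m ] (𝟙 (a k ≟ g) ℕ.+ 𝟙 (b k ≟ g))       ≡⟨ ∑<-halves m (λ s → 𝟙 (a s ≟ g)) ⟨
    χ₀ g                                           ∎
    where open ≡.≡-Reasoning

  count-InternalDiffs-∑ : ∀ g → count g (InternalDiffs D) ≡ ∑[ k < m ] count g (Δ (C₂ₖ k))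
  count-InternalDiffs-∑ g =
    ≡.trans (count-concatMap-tabulate g (e / 2) id (Δ ∘ D) (λ k → count g (Δ (C₂ₖ k))) (λ _ → refl))
            (∑-over-classes _)

  count-InternalDiffs : ∀ g → count g (InternalDiffs D) ≡ χ₀ (two ⁻¹ * g)
  count-InternalDiffs g = begin
    count g (InternalDiffs D)                      ≡⟨ count-InternalDiffs-∑ g ⟩
    ∑[ k < m ] count g (Δ (C₂ₖ k))                 ≡⟨ ∑<-cong m (λ k _ → count-Δ-C₂ₖ g k) ⟩
    ∑[ k < m ] (𝟙 ((a k - b k) ≟ g) ℕ.+ 𝟙 ((b k - a k) ≟ g))
      ≡⟨ ∑<-cong m (λ k _ → cong₂ ℕ._+_ (≡.trans (𝟙≈-cong (a-b≈two*a k) ≈-refl) (𝟙-scale two≉0 (a k) g))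
                                          (≡.trans (𝟙≈-cong (b-a≈two*b k) ≈-refl) (𝟙-scale two≉0 (b k) g))) ⟩
    ∑[ k < m ] (𝟙 (a k ≟ (two ⁻¹ * g)) ℕ.+ 𝟙 (b k ≟ (two ⁻¹ * g)))
      ≡⟨ ∑<-halves m (λ s → 𝟙 (a s ≟ (two ⁻¹ * g))) ⟨
    χ₀ (two ⁻¹ * g)                                ∎
    where open ≡.≡-Reasoning

  c₂ : Carrier → ℕ → ℕ → ℕ
  c₂ g k l = count g (Δ₂ (C₂ₖ k) (C₂ₖ l))

  count-ExternalDiffs : ∀ g → count g (ExternalDiffs D) ≡ ∑[ k < m ] ∑[ l < m ] (𝟙 (¬? (l ℕ.≟ k)) ℕ.* c₂ g k l)
  count-ExternalDiffs g = count-offDiagonal _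
    where
    open ≡.≡-Reasoning
    M : ℕ
    M = e / 2
    weight : ∀ {i j : Fin M} (i≢j? : Dec (¬ i ≡ j)) → 𝟙 i≢j? ≡ 𝟙 (¬? (toℕ j ℕ.≟ toℕ i))
    weight {i} {j} i≢j? = 𝟙-⇔ i≢j? (¬? (toℕ j ℕ.≟ toℕ i))
      (λ i≢j j≡i → i≢j (Finₚ.toℕ-injective (≡.sym j≡i))) (λ j≢i i≡j → j≢i (cong toℕ (≡.sym i≡j)))
    count-offDiagonal : (≢? : ∀ (i j : Fin M) → Dec (¬ i ≡ j)) →
      count g (concatMap (λ i → concatMap (λ j → Δ₂ (D i) (D j)) (filter (≢? i) (allFin M))) (allFin M))
        ≡ ∑[ k < m ] ∑[ l < m ] (𝟙 (¬? (l ℕ.≟ k)) ℕ.* c₂ g k l)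
    count-offDiagonal ≢? = begin
      count g (concatMap (λ i → concatMap (λ j → Δ₂ (D i) (D j)) (filter (≢? i) (allFin M))) (allFin M))
        ≡⟨ count-concatMap-tabulate g M id _ (λ k → ∑[ l < M ] (𝟙 (¬? (l ℕ.≟ k)) ℕ.* c₂ g k l))
             (λ i → count-concatMap-filter-tabulate g M id (≢? i) _ _
                      (λ j → cong (ℕ._* c₂ g (toℕ i) (toℕ j)) (weight (≢? i j)))) ⟩
      ∑[ k < M ] ∑[ l < M ] (𝟙 (¬? (l ℕ.≟ k)) ℕ.* c₂ g k l)
        ≡⟨ cong (λ N → ∑[ k < N ] ∑[ l < N ] (𝟙 (¬? (l ℕ.≟ k)) ℕ.* c₂ g k l)) e/2≡m ⟩
      ∑[ k < m ] ∑[ l < m ] (𝟙 (¬? (l ℕ.≟ k)) ℕ.* c₂ g k l) ∎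

  ∑∑c₂≡squarePairs : ∀ g → ∑[ k < m ] ∑[ l < m ] c₂ g k l ≡ squarePairs g
  ∑∑c₂≡squarePairs g = begin
    ∑[ k < m ] ∑[ l < m ] c₂ g k l
      ≡⟨ ∑<-cong m (λ k _ → ∑<-cong m (λ l _ → count-Δ₂-C₂ₖ g k l)) ⟩
    ∑[ k < m ] ∑[ l < m ] ((K k l ℕ.+ K k (m ℕ.+ l)) ℕ.+ (K (m ℕ.+ k) l ℕ.+ K (m ℕ.+ k) (m ℕ.+ l)))
      ≡⟨ ∑<-cong m (λ k _ → ∑<-distrib-+ m _ _) ⟩
    ∑[ k < m ] (∑[ l < m ] (K k l ℕ.+ K k (m ℕ.+ l)) ℕ.+ ∑[ l < m ] (K (m ℕ.+ k) l ℕ.+ K (m ℕ.+ k) (m ℕ.+ l)))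
      ≡⟨ ∑<-cong m (λ k _ → cong₂ ℕ._+_ (∑<-halves m (K k)) (∑<-halves m (K (m ℕ.+ k)))) ⟨
    ∑[ k < m ] (∑< (m ℕ.+ m) (K k) ℕ.+ ∑< (m ℕ.+ m) (K (m ℕ.+ k)))
      ≡⟨ ∑<-halves m (λ s → ∑< (m ℕ.+ m) (K s)) ⟨
    ∑[ s < m ℕ.+ m ] ∑[ t < m ℕ.+ m ] K s t
      ≡⟨ ∑<-comm (m ℕ.+ m) (m ℕ.+ m) K ⟩
    ∑[ t < m ℕ.+ m ] ∑[ s < m ℕ.+ m ] K s t
      ≡⟨ ∑<-cong (m ℕ.+ m) (λ t _ → ∑<-cong (m ℕ.+ m) (λ s _ → 𝟙-shift (a s) (a t) g)) ⟩
    ∑[ t < m ℕ.+ m ] χ₀ (g + a t)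
      ≡⟨ ∑𝔽-χ₀* (λ y → χ₀ (g + y)) ⟨
    squarePairs g ∎
    where
    open ≡.≡-Reasoning
    K : ℕ → ℕ → ℕ
    K s t = 𝟙 ((a s - a t) ≟ g)

  count-ExternalDiffs+diagonal : ∀ g → count g (ExternalDiffs D) ℕ.+ ∑[ k < m ] c₂ g k k ≡ squarePairs g
  count-ExternalDiffs+diagonal g = begin
    count g (ExternalDiffs D) ℕ.+ ∑[ k < m ] c₂ g k k
      ≡⟨ cong (ℕ._+ ∑[ k < m ] c₂ g k k) (count-ExternalDiffs g) ⟩
    ∑[ k < m ] ∑[ l < m ] (𝟙 (¬? (l ℕ.≟ k)) ℕ.* c₂ g k l) ℕ.+ ∑[ k < m ] c₂ g k k
      ≡⟨ ∑<-distrib-+ m _ _ ⟨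
    ∑[ k < m ] (∑[ l < m ] (𝟙 (¬? (l ℕ.≟ k)) ℕ.* c₂ g k l) ℕ.+ c₂ g k k)
      ≡⟨ ∑<-cong m (λ k k<m → ∑<-removeDiagonal m (c₂ g k) k<m) ⟩
    ∑[ k < m ] ∑[ l < m ] c₂ g k l
      ≡⟨ ∑∑c₂≡squarePairs g ⟩
    squarePairs g ∎
    where open ≡.≡-Reasoning

  private
    𝟙[x-x≟g] : ∀ x g → 𝟙 ((x - x) ≟ g) ≡ 𝟙 (0# ≟ g)
    𝟙[x-x≟g] x g = 𝟙≈-cong (-‿inverseʳ x) ≈-refl

    a-b≉0 : ∀ k → a k - b k ≉ 0#
    a-b≉0 k = *-≉0 two≉0 (α^≉0 (k ℕ.+ k)) ∘ ≈-trans (≈-sym (a-b≈two*a k))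

    b-a≉0 : ∀ k → b k - a k ≉ 0#
    b-a≉0 k = *-≉0 two≉0 (α^≉0 ((m ℕ.+ k) ℕ.+ (m ℕ.+ k))) ∘ ≈-trans (≈-sym (b-a≈two*b k))

  c₂-diagonal-≉0 : ∀ {g} → g ≉ 0# → ∀ k → c₂ g k k ≡ count g (Δ (C₂ₖ k))
  c₂-diagonal-≉0 {g} g≉0 k = begin
    c₂ g k k
      ≡⟨ count-Δ₂-C₂ₖ g k k ⟩
    (𝟙 ((a k - a k) ≟ g) ℕ.+ 𝟙 ((a k - b k) ≟ g)) ℕ.+ (𝟙 ((b k - a k) ≟ g) ℕ.+ 𝟙 ((b k - b k) ≟ g))
      ≡⟨ cong₂ (λ i j → (i ℕ.+ 𝟙 ((a k - b k) ≟ g)) ℕ.+ (𝟙 ((b k - a k) ≟ g) ℕ.+ j))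
               (≡.trans (𝟙[x-x≟g] (a k) g) 0≠g) (≡.trans (𝟙[x-x≟g] (b k) g) 0≠g) ⟩
    𝟙 ((a k - b k) ≟ g) ℕ.+ (𝟙 ((b k - a k) ≟ g) ℕ.+ 0)
      ≡⟨ cong (𝟙 ((a k - b k) ≟ g) ℕ.+_) (ℕₚ.+-identityʳ _) ⟩
    𝟙 ((a k - b k) ≟ g) ℕ.+ 𝟙 ((b k - a k) ≟ g)
      ≡⟨ count-Δ-C₂ₖ g k ⟨
    count g (Δ (C₂ₖ k)) ∎
    where
    open ≡.≡-Reasoning
    0≠g : 𝟙 (0# ≟ g) ≡ 0
    0≠g = 𝟙-no (0# ≟ g) (g≉0 ∘ ≈-sym)

  c₂-diagonal-≈0 : ∀ {g} → g ≈ 0# → ∀ k → c₂ g k k ≡ 2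
  c₂-diagonal-≈0 {g} g≈0 k = ≡.trans (count-Δ₂-C₂ₖ g k k)
    (cong₂ ℕ._+_ (cong₂ ℕ._+_ (≡.trans (𝟙[x-x≟g] (a k) g) 0≈g) (𝟙-no ((a k - b k) ≟ g) (a-b≉0 k ∘ λ p → ≈-trans p g≈0)))
                 (cong₂ ℕ._+_ (𝟙-no ((b k - a k) ≟ g) (b-a≉0 k ∘ λ p → ≈-trans p g≈0)) (≡.trans (𝟙[x-x≟g] (b k) g) 0≈g)))
    where
    0≈g : 𝟙 (0# ≟ g) ≡ 1
    0≈g = 𝟙-yes (0# ≟ g) (≈-sym g≈0)

  count-ExternalDiffs+InternalDiffs : ∀ {g} → g ≉ 0# →
    count g (ExternalDiffs D) ℕ.+ count g (InternalDiffs D) ≡ squarePairs g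
  count-ExternalDiffs+InternalDiffs {g} g≉0 = ≡.trans
    (cong (count g (ExternalDiffs D) ℕ.+_)
          (≡.trans (count-InternalDiffs-∑ g) (≡.sym (∑<-cong m (λ k _ → c₂-diagonal-≉0 g≉0 k)))))
    (count-ExternalDiffs+diagonal g)

  -- At g = 0 every class contributes the two trivial differences x − x to its diagonal term,
  -- and these already exhaust the m + m pairs of squares with difference 0.
  count-ExternalDiffs-zero : ∀ {g} → g ≈ 0# → count g (ExternalDiffs D) ≡ 0
  count-ExternalDiffs-zero {g} g≈0 = ℕₚ.+-cancelʳ-≡ (m ℕ.+ m) _ 0 (begin
    count g (ExternalDiffs D) ℕ.+ (m ℕ.+ m)     ≡⟨ cong (count g (ExternalDiffs D) ℕ.+_) diagonal≡m+m ⟨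
    count g (ExternalDiffs D) ℕ.+ ∑[ k < m ] c₂ g k k
                                                ≡⟨ count-ExternalDiffs+diagonal g ⟩
    squarePairs g                               ≡⟨ ∑𝔽-χ₀* (λ y → χ₀ (g + y)) ⟩
    ∑[ t < m ℕ.+ m ] χ₀ (g + a t)               ≡⟨ ∑<-cong (m ℕ.+ m) (λ t _ → χ₀-g+a t) ⟩
    ∑[ t < m ℕ.+ m ] 1                          ≡⟨ ≡.trans (∑<-const (m ℕ.+ m) 1) (ℕₚ.*-identityʳ (m ℕ.+ m)) ⟩
    m ℕ.+ m                                     ∎)
    where
    open ≡.≡-Reasoning
    diagonal≡m+m : ∑[ k < m ] c₂ g k k ≡ m ℕ.+ m
    diagonal≡m+m = begin
      ∑[ k < m ] c₂ g k k    ≡⟨ ∑<-cong m (λ k _ → c₂-diagonal-≈0 g≈0 k) ⟩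
      ∑[ k < m ] 2           ≡⟨ ∑<-const m 2 ⟩
      m ℕ.* 2                ≡⟨ ℕₚ.*-comm m 2 ⟩
      m ℕ.+ (m ℕ.+ 0)        ≡⟨ cong (m ℕ.+_) (ℕₚ.+-identityʳ m) ⟩
      m ℕ.+ m                ∎
    χ₀-g+a : ∀ t → χ₀ (g + a t) ≡ 1
    χ₀-g+a t = ≡.trans (χ₀-cong (≈-trans (+-congʳ g≈0) (+-identityˡ (a t))))
                       (≡.trans (χ₀-α^ (t ℕ.+ t)) (cong (1 ∸_) (even%2 t)))

  private
    a-injective : ∀ {s t} → s < m ℕ.+ m → t < m ℕ.+ m → a s ≈ a t → s ≡ t
    a-injective s<e t<e as≈at = +-self-injective (α^-injective (ℕₚ.+-mono-< s<e s<e) (ℕₚ.+-mono-< t<e t<e) as≈at)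

    class-index<e : ∀ {k s} → k < m → s ≡ k ⊎ s ≡ m ℕ.+ k → s < m ℕ.+ m
    class-index<e {k} k<m (inj₁ refl) = ℕₚ.<-≤-trans k<m (ℕₚ.m≤m+n m m)
    class-index<e {k} k<m (inj₂ refl) = ℕₚ.+-monoʳ-< m k<m

    toℕ<m : ∀ (i : Fin (e / 2)) → toℕ i < m
    toℕ<m i = subst (toℕ i <_) e/2≡m (Finₚ.toℕ<n i)

  ∈C₂ₖ : ∀ {g} k → g ∈ C₂ₖ k → Σ[ s ∈ ℕ ] (s ≡ k ⊎ s ≡ m ℕ.+ k) × a s ≈ g
  ∈C₂ₖ {g} k g∈C₂ₖ with subst (g ∈_) (C₂ₖ≡ k) g∈C₂ₖ
  ... | here α^2k≈g          = k , inj₁ refl , ≈-trans (≈-sym (α^2k≈a k)) α^2k≈g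
  ... | there (here α^2k+e≈g) = m ℕ.+ k , inj₂ refl , ≈-trans (≈-sym (α^[2k+e]≈b k)) α^2k+e≈g

  D-disjoint : DisjointKSubsets D 2
  D-disjoint = (λ i → cong length (C₂ₖ≡ (toℕ i)))
             , (λ i → subst (All (_≉ 0#)) (≡.sym (C₂ₖ≡ (toℕ i))) (α^≉0 (2 ℕ.* toℕ i) ∷ α^≉0 (2 ℕ.* toℕ i ℕ.+ e) ∷ []))
             , (λ i g g∈Dᵢ → ≡.trans (cong (count g) (C₂ₖ≡ (toℕ i)))
                                     (count-pair-∈ (α^2k≉α^[2k+e] (toℕ i)) (subst (g ∈_) (C₂ₖ≡ (toℕ i)) g∈Dᵢ)))
             , λ i j g i≢j g∈Dᵢ g∈Dⱼ →
                 i≢j (Finₚ.toℕ-injective (sameClass (toℕ<m i) (toℕ<m j) (∈C₂ₖ _ g∈Dᵢ) (∈C₂ₖ _ g∈Dⱼ)))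
    where
    α^2k≉α^[2k+e] : ∀ k → α ^ (2 ℕ.* k) ≉ α ^ (2 ℕ.* k ℕ.+ e)
    α^2k≉α^[2k+e] k p = a≉b k (≈-trans (≈-sym (α^2k≈a k)) (≈-trans p (α^[2k+e]≈b k)))
    sameClass : ∀ {g k l} → k < m → l < m → Σ[ s ∈ ℕ ] (s ≡ k ⊎ s ≡ m ℕ.+ k) × a s ≈ g →
                Σ[ t ∈ ℕ ] (t ≡ l ⊎ t ≡ m ℕ.+ l) × a t ≈ g → k ≡ l
    sameClass k<m l<m (s , s∈ , as≈g) (t , t∈ , at≈g) = lower-or-upper-half k<m l<m s∈ (subst (λ u → u ≡ _ ⊎ u ≡ m ℕ.+ _) t≡s t∈)
      where
      t≡s : t ≡ s
      t≡s = ≡.sym (a-injective (class-index<e k<m s∈) (class-index<e l<m t∈) (≈-trans as≈g (≈-sym at≈g)))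

  χ₁-∈Union : ∀ {g} → g ≉ 0# → g ∈ Union D → χ₁ g ≡ 0
  χ₁-∈Union {g} g≉0 g∈S with ≤1⇒≡0⊎≡1 (χ₁≤1 g)
  ... | inj₁ χ₁g≡0 = χ₁g≡0
  ... | inj₂ χ₁g≡1 = ⊥-elim (ℕₚ.<-irrefl (≡.sym χ₀g≡0) (subst (0 <_) (count-Union g) (∈⇒count>0 (Union D) g∈S)))
    where
    χ₀g≡0 : χ₀ g ≡ 0
    χ₀g≡0 = ≡.trans (χ₀≡1∸χ₁ g≉0) (cong (1 ∸_) χ₁g≡1)

  χ₁-∉Union : ∀ {g} → g ≉ 0# → g ∉ Union D → χ₁ g ≡ 1
  χ₁-∉Union {g} g≉0 g∉S with ≤1⇒≡0⊎≡1 (χ₁≤1 g)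
  ... | inj₂ χ₁g≡1 = χ₁g≡1
  ... | inj₁ χ₁g≡0 = ⊥-elim (g∉S (count>0⇒∈ (Union D) (subst (0 <_) (≡.sym (≡.trans (count-Union g) χ₀g≡1)) (s≤s z≤n))))
    where
    χ₀g≡1 : χ₀ g ≡ 1
    χ₀g≡1 = ≡.trans (χ₀≡1∸χ₁ g≉0) (cong (1 ∸_) χ₁g≡0)

  count-InternalDiffs-2∈C₀ : χ₁ two ≡ 0 → ∀ g → count g (InternalDiffs D) ≡ χ₀ g
  count-InternalDiffs-2∈C₀ χ₁two≡0 g =
    ≡.trans (count-InternalDiffs g) (χ₀-*-square (⁻¹-≉0 two≉0) (≡.trans (χ₁-⁻¹ two≉0) χ₁two≡0) g)

  count-InternalDiffs-2∈C₁ : χ₁ two ≡ 1 → ∀ g → count g (InternalDiffs D) ≡ χ₁ g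
  count-InternalDiffs-2∈C₁ χ₁two≡1 g =
    ≡.trans (count-InternalDiffs g) (χ₀-*-nonsquare (⁻¹-≉0 two≉0) (≡.trans (χ₁-⁻¹ two≉0) χ₁two≡1) g)

  count-ExternalDiffs≡ : ∀ {g} → g ≉ 0# → count g (ExternalDiffs D) ≡ squarePairs g ∸ count g (InternalDiffs D)
  count-ExternalDiffs≡ {g} g≉0 = ≡.trans (≡.sym (ℕₚ.m+n∸n≡m _ (count g (InternalDiffs D))))
                                         (cong (_∸ count g (InternalDiffs D)) (count-ExternalDiffs+InternalDiffs g≉0))

  χ₀-∈Union : ∀ {g} → g ≉ 0# → g ∈ Union D → χ₀ g ≡ 1
  χ₀-∈Union g≉0 g∈S = ≡.trans (χ₀≡1∸χ₁ g≉0) (cong (1 ∸_) (χ₁-∈Union g≉0 g∈S))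

  χ₀-∉Union : ∀ {g} → g ≉ 0# → g ∉ Union D → χ₀ g ≡ 0
  χ₀-∉Union g≉0 g∉S = ≡.trans (χ₀≡1∸χ₁ g≉0) (cong (1 ∸_) (χ₁-∉Union g≉0 g∉S))

  m-even⇒isDisjointPDF : m % 2 ≡ 0 → IsDisjointPDF (e / 2) D 2 1 0
  m-even⇒isDisjointPDF m-even = D-disjoint
    , (λ g g≈0 → ≡.trans (count-InternalDiffs-2∈C₀ (≡.trans χ₁-two m-even) g) (χ₀-zero g≈0))
    , (λ g g≉0 g∈S → ≡.trans (count-InternalDiffs-2∈C₀ (≡.trans χ₁-two m-even) g) (χ₀-∈Union g≉0 g∈S))
    , (λ g g≉0 g∉S → ≡.trans (count-InternalDiffs-2∈C₀ (≡.trans χ₁-two m-even) g) (χ₀-∉Union g≉0 g∉S))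

  m-even⇒isExternalPDF : m % 2 ≡ 0 → IsExternalPDF (e / 2) D 2 (m ∸ 2) m
  m-even⇒isExternalPDF m-even = D-disjoint
    , (λ g g≈0 → count-ExternalDiffs-zero g≈0)
    , (λ g g≉0 g∈S → ≡.trans (count-ExternalDiffs≡ g≉0)
         (≡.trans (cong₂ _∸_ (squarePairs-square g≉0 (χ₁-∈Union g≉0 g∈S))
                            (≡.trans (count-InternalDiffs-2∈C₀ (≡.trans χ₁-two m-even) g) (χ₀-∈Union g≉0 g∈S)))
                  (ℕₚ.∸-+-assoc m 1 1)))
    , (λ g g≉0 g∉S → ≡.trans (count-ExternalDiffs≡ g≉0)
         (cong₂ _∸_ (squarePairs-nonsquare g≉0 (χ₁-∉Union g≉0 g∉S))
                    (≡.trans (count-InternalDiffs-2∈C₀ (≡.trans χ₁-two m-even) g) (χ₀-∉Union g≉0 g∉S))))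

  m-odd⇒isDisjointPDF : m % 2 ≡ 1 → IsDisjointPDF (e / 2) D 2 0 1
  m-odd⇒isDisjointPDF m-odd = D-disjoint
    , (λ g g≈0 → ≡.trans (count-InternalDiffs-2∈C₁ (≡.trans χ₁-two m-odd) g) (χ₁-zero g≈0))
    , (λ g g≉0 g∈S → ≡.trans (count-InternalDiffs-2∈C₁ (≡.trans χ₁-two m-odd) g) (χ₁-∈Union g≉0 g∈S))
    , (λ g g≉0 g∉S → ≡.trans (count-InternalDiffs-2∈C₁ (≡.trans χ₁-two m-odd) g) (χ₁-∉Union g≉0 g∉S))

  m-odd⇒isEDF : m % 2 ≡ 1 → IsEDF (e / 2) D 2 (m ∸ 1)
  m-odd⇒isEDF m-odd = D-disjoint
    , (λ g g≈0 → count-ExternalDiffs-zero g≈0)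
    , λ g g≉0 → ≡.trans (count-ExternalDiffs≡ g≉0) (byClass g≉0 (≤1⇒≡0⊎≡1 (χ₁≤1 g)))
    where
    byClass : ∀ {g} → g ≉ 0# → χ₁ g ≡ 0 ⊎ χ₁ g ≡ 1 → squarePairs g ∸ count g (InternalDiffs D) ≡ m ∸ 1
    byClass {g} g≉0 (inj₁ χ₁g≡0) =
      cong₂ _∸_ (squarePairs-square g≉0 χ₁g≡0) (≡.trans (count-InternalDiffs-2∈C₁ (≡.trans χ₁-two m-odd) g) χ₁g≡0)
    byClass {g} g≉0 (inj₂ χ₁g≡1) =
      cong₂ _∸_ (squarePairs-nonsquare g≉0 χ₁g≡1) (≡.trans (count-InternalDiffs-2∈C₁ (≡.trans χ₁-two m-odd) g) χ₁g≡1)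

module _ where
  open import Data.Nat using (_+_; _*_)
  open ≡.≡-Reasoning

  [q∸1]/4 : ∀ m → (suc (4 * m) ∸ 1) / 4 ≡ m
  [q∸1]/4 m = ≡.trans (cong (_/ 4) (ℕₚ.*-comm 4 m)) (m*n/n≡m m 4)

  [q∸5]/4 : ∀ m → (suc (4 * m) ∸ 5) / 4 ≡ m ∸ 1
  [q∸5]/4 m = ≡.trans (cong (_/ 4) (≡.trans (≡.sym (ℕₚ.*-distribˡ-∸ 4 m 1)) (ℕₚ.*-comm 4 (m ∸ 1))))
                      (m*n/n≡m (m ∸ 1) 4)

  [q∸9]/4 : ∀ m → (suc (4 * m) ∸ 9) / 4 ≡ m ∸ 2
  [q∸9]/4 m = ≡.trans (cong (_/ 4) (≡.trans (≡.sym (ℕₚ.*-distribˡ-∸ 4 m 2)) (ℕₚ.*-comm 4 (m ∸ 2))))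
                      (m*n/n≡m (m ∸ 2) 4)

  q%8 : ∀ m → suc (4 * m) % 8 ≡ suc (4 * (m % 2)) % 8
  q%8 m = begin
    suc (4 * m) % 8                        ≡⟨ cong (λ k → suc (4 * k) % 8) (m≡m%n+[m/n]*n m 2) ⟩
    suc (4 * (m % 2 + m / 2 * 2)) % 8      ≡⟨ cong (_% 8) (solve 2 (λ r t → con 1 :+ con 4 :* (r :+ t :* con 2)
                                                                     := (con 1 :+ con 4 :* r) :+ t :* con 8) refl (m % 2) (m / 2)) ⟩
    (suc (4 * (m % 2)) + m / 2 * 8) % 8    ≡⟨ [m+kn]%n≡m%n (suc (4 * (m % 2))) (m / 2) 8 ⟩
    suc (4 * (m % 2)) % 8                  ∎
    where open +-*-Solver

  q%8≡1⇒m-even : ∀ m → suc (4 * m) % 8 ≡ 1 → m % 2 ≡ 0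
  q%8≡1⇒m-even m q%8≡1 with ≤1⇒≡0⊎≡1 (ℕₚ.≤-pred (m%n<n m 2))
  ... | inj₁ m%2≡0 = m%2≡0
  ... | inj₂ m%2≡1 with ≡.trans (≡.sym q%8≡1) (≡.trans (q%8 m) (cong (λ r → suc (4 * r) % 8) m%2≡1))
  ... | ()

  q%8≡5⇒m-odd : ∀ m → suc (4 * m) % 8 ≡ 5 → m % 2 ≡ 1
  q%8≡5⇒m-odd m q%8≡5 with ≤1⇒≡0⊎≡1 (ℕₚ.≤-pred (m%n<n m 2))
  ... | inj₂ m%2≡1 = m%2≡1
  ... | inj₁ m%2≡0 with ≡.trans (≡.sym q%8≡5) (≡.trans (q%8 m) (cong (λ r → suc (4 * r) % 8) m%2≡0))
  ... | ()

open FiniteField using (Carrier; IsPrimitive; order; IsDisjointPDF; IsExternalPDF; IsEDF; C02')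

theorem5p13 : (F : FiniteField) →
    (α : Carrier F) → IsPrimitive F α →
    (e : ℕ) → order F ≡ e ℕ.* 2 ℕ.+ 1 → 2 ∣ e → order F % 4 ≡ 1 →
      (order F % 8 ≡ 1 →
          IsDisjointPDF F (e / 2) (C02' F α e) 2 1 0
        × IsExternalPDF F (e / 2) (C02' F α e) 2 ((order F ∸ 9) / 4) ((order F ∸ 1) / 4))
    × (order F % 8 ≡ 5 →
          IsDisjointPDF F (e / 2) (C02' F α e) 2 0 1
        × IsEDF F (e / 2) (C02' F α e) 2 ((order F ∸ 5) / 4))
theorem5p13 F α α-primitive e q≡2e+1 (divides m e≡m*2) _ =
    (λ q%8≡1 → m-even⇒isDisjointPDF (m-even q%8≡1)
             , ≡.subst₂ (IsExternalPDF F (e / 2) (C02' F α e) 2) (≡.sym λ≡m∸2) (≡.sym μ≡m)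
                        (m-even⇒isExternalPDF (m-even q%8≡1)))
  , (λ q%8≡5 → m-odd⇒isDisjointPDF (m-odd q%8≡5)
             , subst (IsEDF F (e / 2) (C02' F α e) 2) (≡.sym λ≡m∸1) (m-odd⇒isEDF (m-odd q%8≡5)))
  where
  open +-*-Solver
  e≡m+m : e ≡ m ℕ.+ m
  e≡m+m = ≡.trans e≡m*2 (solve 1 (λ m → m :* con 2 := m :+ m) refl m)
  q≡1+e+e : order F ≡ suc (e ℕ.+ e)
  q≡1+e+e = ≡.trans q≡2e+1 (solve 1 (λ e → e :* con 2 :+ con 1 := con 1 :+ (e :+ e)) refl e)
  open C02'Family F α α-primitive {m = m} e≡m+m q≡1+e+e
  q≡1+4m : order F ≡ suc (4 ℕ.* m)
  q≡1+4m = ≡.trans q≡2e+1 (≡.trans (cong (λ e → e ℕ.* 2 ℕ.+ 1) e≡m*2)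
                                   (solve 1 (λ m → m :* con 2 :* con 2 :+ con 1 := con 1 :+ con 4 :* m) refl m))
  m-even : order F % 8 ≡ 1 → m % 2 ≡ 0
  m-even q%8≡1 = q%8≡1⇒m-even m (subst (λ q → q % 8 ≡ 1) q≡1+4m q%8≡1)
  m-odd : order F % 8 ≡ 5 → m % 2 ≡ 1
  m-odd q%8≡5 = q%8≡5⇒m-odd m (subst (λ q → q % 8 ≡ 5) q≡1+4m q%8≡5)
  μ≡m : (order F ∸ 1) / 4 ≡ m
  μ≡m = ≡.trans (cong (λ q → (q ∸ 1) / 4) q≡1+4m) ([q∸1]/4 m)
  λ≡m∸1 : (order F ∸ 5) / 4 ≡ m ∸ 1
  λ≡m∸1 = ≡.trans (cong (λ q → (q ∸ 5) / 4) q≡1+4m) ([q∸5]/4 m)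
  λ≡m∸2 : (order F ∸ 9) / 4 ≡ m ∸ 2
  λ≡m∸2 = ≡.trans (cong (λ q → (q ∸ 9) / 4) q≡1+4m) ([q∸9]/4 m)
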